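{- A connected graph $G$ is a cograph if and only if its split tree $ST(G)=(T,\mathcal{F})$ is a clique-star tree and there exists a clique node of $T$ or a tree-edge of $T$ towards which all the star nodes of $T$ are oriented.
   Context: A cograph is a graph with no induced path on four vertices. A graph-labelled tree $(T,\mathcal{F})$: a tree $T$ whose internal vertices (nodes) $v$ of degree $k$ carry a graph $G_v$ on $k$ marker vertices and a bijection $\rho_v$ from tree-edges at $v$ to $V(G_v)$; for a leaf $l$, a node or leaf $u\ne l$ is $l$-accessible if for consecutive tree-edges $e=wv,e'=vw'$ on the $l,u$-path, $\rho_v(e)\rho_v(e')\in E(G_v)$; the accessibility graph has the leaves as vertices, $x,y$ adjacent iff $y$ is $x$-accessible. A split of $H$ is a bipartition $(V_1,V_2)$ of $V(H)$, $|V_i|\ge 2$, such that every vertex of $V_2$ with a neighbour in $V_1$ is adjacent to every vertex of $V_1$ with a neighbour in $V_2$; prime = no split; degenerate = clique or star ($K_{1,m}$; the universal vertex is the centre, others extremities). Reduced: all nodes of degree $\ge3$, no two adjacent clique nodes, no adjacent star nodes $u,v$ with $\rho_u(uv)$ the centre of $G_u$ and $\rho_v(uv)$ an extremity of $G_v$. The split tree $ST(G)$ is the unique reduced graph-labelled tree with accessibility graph $G$ whose labels are prime or degenerate. A clique-star tree has all labels cliques or stars. A star node $u$ is oriented towards a node $w\ne u$ (resp. a tree-edge $e$) if the tree-edge $\rho_u^{ -1}(\text{centre of }G_u)$ lies on the shortest path of $T$ containing $u$ and $w$ (resp. $u$ and $e$). -}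

module Defs where

open import Data.Nat using (ℕ; _≤_; _<_)
open import Data.Fin using (Fin)
open import Data.Bool using (Bool; true; false; T)
open import Data.List using (List; []; _∷_; _++_; length; head; last)
open import Data.List.Relation.Unary.Linked using (Linked)
open import Data.List.Relation.Unary.Unique.Propositional using (Unique)
open import Data.Maybe using (just)
open import Data.Product using (Σ; ∃; ∃-syntax; _×_)
open import Data.Sum using (_⊎_)
open import Data.Unit using (⊤)
open import Data.Empty using (⊥)
open import Relation.Nullary using (¬_)
open import Relation.Binary.PropositionalEquality using (_≡_; _≢_)
open import Function.Bundles using (_⇔_)

record Graph (n : ℕ) : Set where
  field
    adj    : Fin n → Fin n → Bool
    sym    : ∀ x y → adj x y ≡ adj y x
    irrefl : ∀ x → adj x x ≡ false
open Graph public

Edge : ∀ {n} → (Fin n → Fin n → Bool) → Fin n → Fin n → Set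
Edge E x y = T (E x y)

WalkFromTo : ∀ {n} → (Fin n → Fin n → Bool) → Fin n → Fin n → List (Fin n) → Set
WalkFromTo E x y p = Linked (Edge E) p × head p ≡ just x × last p ≡ just y

PathFromTo : ∀ {n} → (Fin n → Fin n → Bool) → Fin n → Fin n → List (Fin n) → Set
PathFromTo E x y p = WalkFromTo E x y p × Unique p

ConnectedRel : ∀ {n} → (Fin n → Fin n → Bool) → Set
ConnectedRel E = ∀ x y → ∃[ p ] WalkFromTo E x y p

Connected : ∀ {n} → Graph n → Set
Connected G = ConnectedRel (adj G)

HasCycle : ∀ {n} → (Fin n → Fin n → Bool) → Set
HasCycle E = ∃[ x ] ∃[ y ] ∃[ p ] (3 ≤ length p × PathFromTo E x y p × Edge E y x)

InducedP4 : ∀ {n} → Graph n → Fin n → Fin n → Fin n → Fin n → Set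
InducedP4 G a b c d =
  a ≢ b × a ≢ c × a ≢ d × b ≢ c × b ≢ d × c ≢ d ×
  Edge (adj G) a b × Edge (adj G) b c × Edge (adj G) c d ×
  ¬ Edge (adj G) a c × ¬ Edge (adj G) a d × ¬ Edge (adj G) b d

IsCograph : ∀ {n} → Graph n → Set
IsCograph G = ∀ a b c d → ¬ InducedP4 G a b c d

-- The label G_v of a node v is a graph
-- whose marker vertices are identified (via ρ_v) with the tree-edges at v,
-- i.e. with the T-neighbours w of v (ρ_v(vw) is represented by w).
-- lab v w w' says whether ρ_v(vw) ρ_v(vw') is an edge of G_v; it is only
-- meaningful for neighbours w, w' of v.

record GLTree : Set where
  field
    m       : ℕ
    tadj    : Fin m → Fin m → Bool
    tsym    : ∀ x y → tadj x y ≡ tadj y x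
    tirrefl : ∀ x → tadj x x ≡ false
    tconn   : ConnectedRel tadj
    tacyc   : ¬ HasCycle tadj
    lab     : Fin m → Fin m → Fin m → Bool
    labSym  : ∀ v w w' → lab v w w' ≡ lab v w' w
open GLTree public

module _ (𝒯 : GLTree) where

  Adj : Fin (m 𝒯) → Fin (m 𝒯) → Set
  Adj = Edge (tadj 𝒯)

  IsLeaf : Fin (m 𝒯) → Set
  IsLeaf v = ∃[ w ] (Adj v w × (∀ w' → Adj v w' → w' ≡ w))

  IsNode : Fin (m 𝒯) → Set
  IsNode v = ¬ IsLeaf v

  DegreeAtLeast3 : Fin (m 𝒯) → Set
  DegreeAtLeast3 v = ∃[ a ] ∃[ b ] ∃[ c ]
    (Adj v a × Adj v b × Adj v c × a ≢ b × a ≢ c × b ≢ c)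

  LabEdge : Fin (m 𝒯) → Fin (m 𝒯) → Fin (m 𝒯) → Set
  LabEdge v a b = T (lab 𝒯 v a b)

  IsCliqueLabel : Fin (m 𝒯) → Set
  IsCliqueLabel v = ∀ a b → Adj v a → Adj v b → a ≢ b → LabEdge v a b

  IsStarWithCentre : Fin (m 𝒯) → Fin (m 𝒯) → Set
  IsStarWithCentre v c =
    Adj v c ×
    (∀ a → Adj v a → a ≢ c → LabEdge v c a) ×
    (∀ a b → Adj v a → Adj v b → a ≢ c → b ≢ c → a ≢ b → ¬ LabEdge v a b)

  IsStarLabel : Fin (m 𝒯) → Set
  IsStarLabel v = ∃[ c ] IsStarWithCentre v c

  IsExtremity : Fin (m 𝒯) → Fin (m 𝒯) → Set
  IsExtremity v x = Adj v x × ∃[ c ] (c ≢ x × IsStarWithCentre v c)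

  IsSplitOfLabel : Fin (m 𝒯) → (Fin (m 𝒯) → Bool) → Set
  IsSplitOfLabel v side =
    (∃[ a ] ∃[ b ] (a ≢ b × Adj v a × Adj v b × side a ≡ true × side b ≡ true)) ×
    (∃[ a ] ∃[ b ] (a ≢ b × Adj v a × Adj v b × side a ≡ false × side b ≡ false)) ×
    (∀ x y → Adj v x → Adj v y → side x ≡ false → side y ≡ true →
       (∃[ y' ] (Adj v y' × side y' ≡ true × LabEdge v x y')) →
       (∃[ x' ] (Adj v x' × side x' ≡ false × LabEdge v y x')) →
       LabEdge v x y)

  IsPrimeLabel : Fin (m 𝒯) → Set
  IsPrimeLabel v = ∀ side → ¬ IsSplitOfLabel v side

  IsDegenerateLabel : Fin (m 𝒯) → Set
  IsDegenerateLabel v = IsCliqueLabel v ⊎ IsStarLabel v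

  CliqueNode : Fin (m 𝒯) → Set
  CliqueNode v = IsNode v × IsCliqueLabel v

  StarNode : Fin (m 𝒯) → Set
  StarNode v = IsNode v × IsStarLabel v

  AccessibleAlong : List (Fin (m 𝒯)) → Set
  AccessibleAlong (a ∷ b ∷ c ∷ xs) = LabEdge b a c × AccessibleAlong (b ∷ c ∷ xs)
  AccessibleAlong _ = ⊤

  Accessible : Fin (m 𝒯) → Fin (m 𝒯) → Set
  Accessible l u = u ≢ l × ∃[ p ] (PathFromTo (tadj 𝒯) l u p × AccessibleAlong p)

  IsReduced : Set
  IsReduced =
    (∀ v → IsNode v → DegreeAtLeast3 v) ×
    (∀ u v → Adj u v → ¬ (CliqueNode u × CliqueNode v)) ×
    (∀ u v → Adj u v → IsNode u → IsNode v →
       ¬ (IsStarWithCentre u v × IsExtremity v u))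

  AccessibilityGraphIs : ∀ {n} → Graph n → Set
  AccessibilityGraphIs {n} G = Σ (Fin n → Fin (m 𝒯)) λ f →
    (∀ x y → f x ≡ f y → x ≡ y) ×
    (∀ x → IsLeaf (f x)) ×
    (∀ l → IsLeaf l → ∃[ x ] f x ≡ l) ×
    (∀ x y → x ≢ y → (Edge (adj G) x y ⇔ Accessible (f x) (f y)))

  -- 𝒯 is the split tree ST(G) (which is unique, so quantifying over all
  -- such 𝒯 is the same as speaking about ST(G))
  IsSplitTreeOf : ∀ {n} → Graph n → Set
  IsSplitTreeOf G =
    AccessibilityGraphIs G × IsReduced ×
    (∀ v → IsNode v → IsPrimeLabel v ⊎ IsDegenerateLabel v)

  IsCliqueStarTree : Set
  IsCliqueStarTree = ∀ v → IsNode v → IsCliqueLabel v ⊎ IsStarLabel v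

  OrientedTowardsNode : Fin (m 𝒯) → Fin (m 𝒯) → Set
  OrientedTowardsNode u w = u ≢ w × ∃[ c ] (IsStarWithCentre u c ×
    ∃[ p ] PathFromTo (tadj 𝒯) u w (u ∷ c ∷ p))

  -- star node u oriented towards tree-edge {a , b}: the tree-edge u c lies on
  -- the shortest path of T containing u and {a , b}, i.e. on a simple path
  -- starting at u and traversing {a , b}
  OrientedTowardsEdge : Fin (m 𝒯) → Fin (m 𝒯) → Fin (m 𝒯) → Set
  OrientedTowardsEdge u a b = ∃[ c ] (IsStarWithCentre u c ×
    ∃[ z ] ∃[ p ] (PathFromTo (tadj 𝒯) u z (u ∷ c ∷ p) ×
      ∃[ xs ] ∃[ ys ] ((u ∷ c ∷ p ≡ xs ++ a ∷ b ∷ ys) ⊎ (u ∷ c ∷ p ≡ xs ++ b ∷ a ∷ ys))))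

  AllStarsOriented : Set
  AllStarsOriented =
    (∃[ w ] (CliqueNode w × (∀ u → StarNode u → OrientedTowardsNode u w))) ⊎
    (∃[ a ] ∃[ b ] (Adj a b × (∀ u → StarNode u → OrientedTowardsEdge u a b)))

-- If G is a cograph, every label of ST(G) is P4-free: markers lead, along accessible paths,
-- to leaves of G (connectivity of G makes such paths exist), and label edges between markers
-- are exactly G-edges between these leaves.  A P4-free graph has twins, which in a prime label
-- with four or more markers would form a split, so all labels are cliques or stars.  Two stars
-- whose centres point away from each other yield an induced P4 through their extremities and
-- centres (after passing to a nearer star if the path between them is not accessible); hence,
-- from a fixed leaf, the deepest star pointing away from it gives an edge towards which all
-- stars are oriented.  Conversely, if all stars point towards a clique node or an end z of an
-- edge, every path from z to a leaf is accessible.  An induced P4 of G can then not be spread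
-- over several branches at z, as clique and star labels are P4-free, so it lies in one branch;
-- descending along it, this is repeated until the branch is a single leaf.

module Submission where

open import Defs hiding (sym)
open import Data.Nat using (ℕ; zero; suc; _+_; _≤_; _<_; z≤n; s≤s; _≤?_)
open import Data.Nat.Properties
  using (≤-refl; ≤-pred; ≤-trans; <-≤-trans; <-irrefl; ≰⇒>; ≤⇒≯; +-identityʳ; +-suc; m≤m+n; m≤n+m; +-monoˡ-≤;
         module ≤-Reasoning)
open import Data.Fin as Fin using (Fin; _≟_)
open import Data.Fin.Properties using (pigeonhole; any?; all?)
open import Data.Bool using (Bool; true; false; T; not; _∧_; _∨_)
open import Data.Bool.Properties using (not-involutive; not-injective; ¬-not; T-≡) renaming (_≟_ to _≟ᵇ_)
open import Data.List using (List; []; _∷_; _++_; _ʳ++_; length; head; last; lookup; filter; allFin)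
open import Data.List.Properties using (ʳ++-defn; ++-assoc; ++-ʳ++; length-ʳ++; filter-notAll)
open import Data.List.Relation.Unary.Linked as Linked using (Linked; []; [-]; _∷_)
open import Data.List.Relation.Unary.AllPairs using ([]; _∷_)
open import Data.List.Relation.Unary.Unique.Propositional using (Unique)
open import Data.List.Relation.Unary.Unique.Propositional.Properties using (filter⁺; allFin⁺)
open import Data.List.Relation.Unary.All.Properties using (¬Any⇒All¬; All¬⇒¬Any)
open import Data.List.Relation.Unary.Any as Any using (here; there)
open import Data.List.Membership.Propositional using (_∈_; _∉_; find; lose)
open import Data.List.Membership.Propositional.Properties
  using (∈-++⁺ˡ; ∈-++⁺ʳ; ∈-∃++; ∈-lookup; ∈-filter⁺; ∈-filter⁻; ∈-allFin)
open import Data.Maybe using (just)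
open import Data.Product using (∃-syntax; _×_; _,_; proj₁; proj₂)
open import Data.Sum as Sum using (_⊎_; inj₁; inj₂; [_,_])
open import Data.Unit using (tt)
open import Data.Empty using (⊥; ⊥-elim)
open import Function using (_∘_)
open import Function.Bundles using (Equivalence; _⇔_; mk⇔)
open import Relation.Nullary using (¬_; Dec; yes; no; ¬?; does; contradiction)
open import Relation.Nullary.Decidable using (T?; _×-dec_; _→-dec_)
open import Relation.Unary using (Decidable)
open import Relation.Binary using (Symmetric)
open import Relation.Binary.Definitions using (DecidableEquality)
open import Relation.Binary.PropositionalEquality using (_≡_; _≢_; refl; sym; trans; cong; subst; ≢-sym)

module _ {A : Set} where

  unique⇒head∉ : ∀ {x : A} {xs} → Unique (x ∷ xs) → x ∉ xs
  unique⇒head∉ (x≢xs ∷ _) = All¬⇒¬Any x≢xs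

  unique-tail : ∀ {x : A} {xs} → Unique (x ∷ xs) → Unique xs
  unique-tail (_ ∷ u) = u

  unique-∷ : ∀ {x : A} {xs} → x ∉ xs → Unique xs → Unique (x ∷ xs)
  unique-∷ x∉xs u = ¬Any⇒All¬ _ x∉xs ∷ u

  unique-pair : ∀ {x y : A} → x ≢ y → Unique (x ∷ y ∷ [])
  unique-pair x≢y = unique-∷ (λ { (here x≡y) → x≢y x≡y }) (unique-∷ (λ ()) [])

  unique-prefix : ∀ xs {ys : List A} → Unique (xs ++ ys) → Unique xs
  unique-prefix [] u = []
  unique-prefix (x ∷ xs) u =
    unique-∷ (λ x∈xs → unique⇒head∉ u (∈-++⁺ˡ x∈xs)) (unique-prefix xs (unique-tail u))

  unique-suffix : ∀ xs {ys : List A} → Unique (xs ++ ys) → Unique ys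
  unique-suffix [] u = u
  unique-suffix (x ∷ xs) u = unique-suffix xs (unique-tail u)

  unique-middle∉prefix : ∀ xs {y : A} {ys} → Unique (xs ++ y ∷ ys) → y ∉ xs
  unique-middle∉prefix (x ∷ xs) u (here refl) = unique⇒head∉ u (∈-++⁺ʳ xs (here refl))
  unique-middle∉prefix (x ∷ xs) u (there y∈xs) = unique-middle∉prefix xs (unique-tail u) y∈xs

  unique-ʳ++ : ∀ xs {ys : List A} → Unique xs → Unique ys →
    (∀ {a} → a ∈ xs → a ∉ ys) → Unique (xs ʳ++ ys)
  unique-ʳ++ [] _ uys _ = uys
  unique-ʳ++ (x ∷ xs) uxs uys disjoint =
    unique-ʳ++ xs (unique-tail uxs) (unique-∷ (disjoint (here refl)) uys) λ where
      a∈xs (here refl) → unique⇒head∉ uxs a∈xs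
      a∈xs (there a∈ys) → disjoint (there a∈xs) a∈ys

  linked-ʳ++ : {R : A → A → Set} → Symmetric R → ∀ {x} xs {ys} →
    Linked R (x ∷ xs) → Linked R (x ∷ ys) → Linked R (xs ʳ++ x ∷ ys)
  linked-ʳ++ R-sym [] _ l = l
  linked-ʳ++ R-sym (y ∷ xs) (r ∷ lxs) l = linked-ʳ++ R-sym xs lxs (R-sym r ∷ l)

  linked-prefix : ∀ {R : A → A → Set} xs {y ys} → Linked R (xs ++ y ∷ ys) → Linked R (xs ++ y ∷ [])
  linked-prefix [] _ = [-]
  linked-prefix (x ∷ []) (r ∷ _) = r ∷ [-]
  linked-prefix (x ∷ x' ∷ xs) (r ∷ l) = r ∷ linked-prefix (x' ∷ xs) l

  linked-suffix : ∀ {R : A → A → Set} xs {ys} → Linked R (xs ++ ys) → Linked R ys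
  linked-suffix [] l = l
  linked-suffix (x ∷ []) [-] = []
  linked-suffix (x ∷ []) (_ ∷ l) = l
  linked-suffix (x ∷ x' ∷ xs) (_ ∷ l) = linked-suffix (x' ∷ xs) l

  linked-init : ∀ {R : A → A → Set} xs {y} → Linked R (xs ++ y ∷ []) → Linked R xs
  linked-init [] _ = []
  linked-init (x ∷ []) _ = [-]
  linked-init (x ∷ x' ∷ xs) (r ∷ l) = r ∷ linked-init (x' ∷ xs) l

  head-ʳ++ : ∀ (x : A) xs {ys} → head ((x ∷ xs) ʳ++ ys) ≡ last (x ∷ xs)
  head-ʳ++ x [] = refl
  head-ʳ++ x (x' ∷ xs) = head-ʳ++ x' xs

  last-ʳ++ : ∀ xs (y : A) ys → last (xs ʳ++ y ∷ ys) ≡ last (y ∷ ys)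
  last-ʳ++ [] y ys = refl
  last-ʳ++ (x ∷ xs) y ys = last-ʳ++ xs x (y ∷ ys)

  last-++ : ∀ xs (y : A) ys → last (xs ++ y ∷ ys) ≡ last (y ∷ ys)
  last-++ [] y ys = refl
  last-++ (x ∷ []) y ys = refl
  last-++ (x ∷ x' ∷ xs) y ys = last-++ (x' ∷ xs) y ys

  last-∈ : ∀ {a : A} xs → last xs ≡ just a → a ∈ xs
  last-∈ (x ∷ []) refl = here refl
  last-∈ (x ∷ x' ∷ xs) eq = there (last-∈ (x' ∷ xs) eq)

  ʳ++-++ : ∀ xs {ys zs : List A} → xs ʳ++ (ys ++ zs) ≡ (xs ʳ++ ys) ++ zs
  ʳ++-++ xs {ys} {zs} = trans (ʳ++-defn xs) (trans (sym (++-assoc _ ys zs)) (cong (_++ zs) (sym (ʳ++-defn xs))))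

  last-linked : ∀ {R : A → A → Set} x xs {y ys} → Linked R ((x ∷ xs) ++ y ∷ ys) →
    ∃[ l ] (last (x ∷ xs) ≡ just l × R l y)
  last-linked x [] (r ∷ _) = x , refl , r
  last-linked x (x' ∷ xs) (_ ∷ l) = last-linked x' xs l

  linked-crossing : ∀ {R : A → A → Set} {P : A → Set} → Decidable P → ∀ {x y} ws →
    Linked R ws → head ws ≡ just x → last ws ≡ just y → P x → ¬ P y →
    ∃[ a ] ∃[ b ] (R a b × P a × ¬ P b)
  linked-crossing P? (w ∷ []) _ refl refl px ¬py = contradiction px ¬py
  linked-crossing P? (w ∷ w' ∷ ws) (r ∷ l) refl last≡ px ¬py with P? w'
  ... | yes pw' = linked-crossing P? (w' ∷ ws) l refl last≡ pw' ¬py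
  ... | no ¬pw' = w , w' , r , px , ¬pw'

  prefix-shorter : ∀ xs {y z w : A} {ys} → length (xs ++ y ∷ z ∷ []) < length (xs ++ y ∷ z ∷ w ∷ ys)
  prefix-shorter [] = s≤s (s≤s (s≤s z≤n))
  prefix-shorter (x ∷ xs) = s≤s (prefix-shorter xs)

  prefix-firstTwo : ∀ xs {y z : A} {ys a b zs} → xs ++ y ∷ z ∷ ys ≡ a ∷ b ∷ zs →
    ∃[ zs' ] xs ++ y ∷ z ∷ [] ≡ a ∷ b ∷ zs'
  prefix-firstTwo [] refl = [] , refl
  prefix-firstTwo (x ∷ []) refl = _ , refl
  prefix-firstTwo (x ∷ x' ∷ xs) refl = xs ++ _ ∷ _ ∷ [] , refl

  unique-head≢ : ∀ xs {y z w : A} {ys} → Unique (xs ++ y ∷ z ∷ ys) → head (xs ++ y ∷ z ∷ ys) ≡ just w →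
    w ≢ z
  unique-head≢ [] u refl refl = unique⇒head∉ u (here refl)
  unique-head≢ (x ∷ xs) u refl refl = unique⇒head∉ u (∈-++⁺ʳ xs (there (here refl)))

  linked-lastTwo : ∀ {R : A → A → Set} {r} xs → Linked R xs → last xs ≡ just r → 2 ≤ length xs →
    ∃[ init ] ∃[ p ] (xs ≡ init ++ p ∷ r ∷ [] × R p r)
  linked-lastTwo (a ∷ []) _ _ (s≤s ())
  linked-lastTwo (a ∷ b ∷ []) (a∼b ∷ _) refl _ = [] , a , refl , a∼b
  linked-lastTwo (a ∷ b ∷ c ∷ xs) (_ ∷ l) last≡ _ with linked-lastTwo (b ∷ c ∷ xs) l last≡ (s≤s (s≤s z≤n))
  ... | init , p , split , p∼r = a ∷ init , p , cong (a ∷_) split , p∼r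

all⊎some : ∀ {k} {P Q : Fin k → Set} → (∀ i → P i ⊎ Q i) → (∀ i → P i) ⊎ ∃[ i ] Q i
all⊎some {zero} _ = inj₁ λ ()
all⊎some {suc k} {P} {Q} either with either Fin.zero | all⊎some {P = P ∘ Fin.suc} {Q ∘ Fin.suc} (either ∘ Fin.suc)
... | inj₂ q | _ = inj₂ (Fin.zero , q)
... | inj₁ _ | inj₂ (i , q) = inj₂ (Fin.suc i , q)
... | inj₁ p | inj₁ ps = inj₁ λ { Fin.zero → p ; (Fin.suc i) → ps i }

true≢false : true ≢ false
true≢false ()

-- P4-free graphs have twins; a graph is a Bool-valued relation E restricted to a vertex list S.
module P4FreeGraphs {A : Set} (_≟_ : DecidableEquality A) where

  IsSymmetric : (A → A → Bool) → Set
  IsSymmetric E = ∀ x y → E x y ≡ E y x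

  P4Free : (A → A → Bool) → List A → Set
  P4Free E S = ∀ {a b c d} → a ∈ S → b ∈ S → c ∈ S → d ∈ S →
    E a b ≡ true → E b c ≡ true → E c d ≡ true →
    E a c ≡ false → E a d ≡ false → E b d ≡ false → ⊥

  complement : (A → A → Bool) → A → A → Bool
  complement E x y = not (E x y)

  p4Free-complement : ∀ {E S} → IsSymmetric E → P4Free E S → P4Free (complement E) S
  p4Free-complement {E} E-sym p4 a∈ b∈ c∈ d∈ ab bc cd ac ad bd =
    p4 c∈ a∈ d∈ b∈ (trans (E-sym _ _) (not-injective ac)) (not-injective ad) (trans (E-sym _ _) (not-injective bd))
      (not-injective cd) (trans (E-sym _ _) (not-injective bc)) (not-injective ab)

  p4Free-⊆ : ∀ {E S S'} → (∀ {x} → x ∈ S' → x ∈ S) → P4Free E S → P4Free E S'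
  p4Free-⊆ S'⊆S p4 a∈ b∈ c∈ d∈ = p4 (S'⊆S a∈) (S'⊆S b∈) (S'⊆S c∈) (S'⊆S d∈)

  record ConstantCut (E : A → A → Bool) (S : List A) : Set where
    constructor constantCut
    field
      side       : A → Bool
      inTrue     : ∃[ x ] (x ∈ S × side x ≡ true)
      inFalse    : ∃[ y ] (y ∈ S × side y ≡ false)
      value      : Bool
      isConstant : ∀ {x y} → x ∈ S → y ∈ S → side x ≡ true → side y ≡ false → E x y ≡ value

  NoEdgeAcross : (A → A → Bool) → List A → (A → Bool) → Set
  NoEdgeAcross E S side = ∀ {x y} → x ∈ S → y ∈ S → side x ≡ true → side y ≡ false → E x y ≡ false

  noEdgeAcross-flip : ∀ {E S side} → IsSymmetric E → NoEdgeAcross E S side →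
    NoEdgeAcross E S (λ x → not (side x))
  noEdgeAcross-flip {side = side} E-sym none {x} {y} x∈ y∈ sx sy =
    trans (E-sym x y) (none y∈ x∈ (not-injective sy) (not-injective sx))

  override : A → Bool → (A → Bool) → A → Bool
  override v b side x with x ≟ v
  ... | yes _ = b
  ... | no _ = side x

  override-≡ : ∀ v b side → override v b side v ≡ b
  override-≡ v b side with v ≟ v
  ... | yes _ = refl
  ... | no v≢v = contradiction refl v≢v

  override-≢ : ∀ {v b side x} → x ≢ v → override v b side x ≡ side x
  override-≢ {v} {x = x} x≢v with x ≟ v
  ... | yes x≡v = contradiction x≡v x≢v
  ... | no _ = refl

  ∈∧∉⇒≢ : ∀ {v : A} {S x} → v ∉ S → x ∈ S → x ≢ v
  ∈∧∉⇒≢ v∉S x∈S refl = v∉S x∈S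

  constantCut-joinFalse : ∀ {E S v} → IsSymmetric E → v ∉ S → (side : A → Bool) →
    ∃[ x ] (x ∈ S × side x ≡ true) → ∃[ y ] (y ∈ S × side y ≡ false) →
    NoEdgeAcross E S side → (∀ {a} → a ∈ S → side a ≡ true → E v a ≡ false) →
    ConstantCut E (v ∷ S)
  constantCut-joinFalse {E} {S} {v} E-sym v∉S side (x , x∈ , sx) (y , y∈ , sy) none v≁true =
    constantCut side' (x , there x∈ , trans (keep x∈) sx) (y , there y∈ , trans (keep y∈) sy) false across
    where
      side' : A → Bool
      side' = override v false side
      keep : ∀ {a} → a ∈ S → side' a ≡ side a
      keep a∈ = override-≢ (∈∧∉⇒≢ v∉S a∈)
      across : NoEdgeAcross E (v ∷ S) side'
      across (here refl) _ s'a _ = contradiction (trans (sym s'a) (override-≡ v false side)) true≢false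
      across (there a∈) (here refl) s'a _ = trans (E-sym _ v) (v≁true a∈ (trans (sym (keep a∈)) s'a))
      across (there a∈) (there b∈) s'a s'b =
        none a∈ b∈ (trans (sym (keep a∈)) s'a) (trans (sym (keep b∈)) s'b)

  constantCut-universal : ∀ {E S v} → v ∉ S → ∃[ y ] (y ∈ S) → (∀ {a} → a ∈ S → E v a ≡ true) →
    ConstantCut E (v ∷ S)
  constantCut-universal {E} {S} {v} v∉S (y , y∈) v∼all =
    constantCut side (v , here refl , override-≡ v true _) (y , there y∈ , override-≢ (∈∧∉⇒≢ v∉S y∈))
      true across
    where
      side : A → Bool
      side = override v true (λ _ → false)
      across : ∀ {a b} → a ∈ v ∷ S → b ∈ v ∷ S → side a ≡ true → side b ≡ false → E a b ≡ true
      across (here refl) (here refl) sa sb = contradiction (trans (sym sa) sb) true≢false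
      across (here refl) (there b∈) _ _ = v∼all b∈
      across (there a∈) _ sa _ = contradiction (trans (sym sa) (override-≢ (∈∧∉⇒≢ v∉S a∈))) true≢false

  -- The new true side consists of the non-neighbours of v on the old one: an edge from such
  -- an a to a neighbour c of v on the true side would give the induced P4  b - v - c - a.
  constantCut-nonNeighbours : ∀ {E S v} → IsSymmetric E → v ∉ S → P4Free E (v ∷ S) →
    (side : A → Bool) → NoEdgeAcross E S side →
    ∀ {x b} → x ∈ S → side x ≡ true → E v x ≡ false → b ∈ S → side b ≡ false → E v b ≡ true →
    ConstantCut E (v ∷ S)
  constantCut-nonNeighbours {E} {S} {v} E-sym v∉S p4 side none {x} {b} x∈ sx v≁x b∈ sb v∼b =
    constantCut side' (x , there x∈ , trans (keep x∈) (chosen sx v≁x)) (v , here refl , override-≡ v false _)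
      false across
    where
      chosen : ∀ {a} → side a ≡ true → E v a ≡ false → side a ∧ not (E v a) ≡ true
      chosen sa v≁a rewrite sa | v≁a = refl
      side' : A → Bool
      side' = override v false (λ a → side a ∧ not (E v a))
      keep : ∀ {a} → a ∈ S → side' a ≡ side a ∧ not (E v a)
      keep a∈ = override-≢ (∈∧∉⇒≢ v∉S a∈)
      chosen⁻ : ∀ a → side a ∧ not (E v a) ≡ true → side a ≡ true × E v a ≡ false
      chosen⁻ a h with side a | E v a
      ... | true | false = refl , refl
      ... | true | true = contradiction (sym h) true≢false
      ... | false | _ = contradiction (sym h) true≢false
      notChosen⁻ : ∀ a → side a ∧ not (E v a) ≡ false → side a ≡ false ⊎ (side a ≡ true × E v a ≡ true)
      notChosen⁻ a h with side a | E v a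
      ... | false | _ = inj₁ refl
      ... | true | true = inj₂ (refl , refl)
      ... | true | false = contradiction h true≢false
      across : NoEdgeAcross E (v ∷ S) side'
      across (here refl) _ s'a _ = contradiction (trans (sym s'a) (override-≡ v false _)) true≢false
      across {a} {c} (there a∈) c∈ s'a s'c with chosen⁻ a (trans (sym (keep a∈)) s'a)
      ... | sa , v≁a with c∈
      ...   | here refl = trans (E-sym a v) v≁a
      ...   | there c∈' with notChosen⁻ c (trans (sym (keep c∈')) s'c)
      ...     | inj₁ sc = none a∈ c∈' sa sc
      ...     | inj₂ (sc , v∼c) with E a c in a∼c
      ...       | false = refl
      ...       | true = ⊥-elim (p4 (there b∈) (here refl) (there c∈') (there a∈)
                    (trans (E-sym b v) v∼b) v∼c (trans (E-sym c a) a∼c)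
                    (trans (E-sym b c) (none c∈' b∈ sc sb))
                    (trans (E-sym b a) (none a∈ b∈ sa sb)) v≁a)

  constantCut-∷ : ∀ {E S v} → IsSymmetric E → v ∉ S → P4Free E (v ∷ S) → (side : A → Bool) →
    ∃[ x ] (x ∈ S × side x ≡ true) → ∃[ y ] (y ∈ S × side y ≡ false) →
    NoEdgeAcross E S side → ConstantCut E (v ∷ S)
  constantCut-∷ {E} {S} {v} E-sym v∉S p4 side inTrue@(x₀ , x₀∈ , sx₀) inFalse@(y₀ , y₀∈ , sy₀) none
    with Any.any? (λ a → (side a ≟ᵇ true) ×-dec (E v a ≟ᵇ true)) S
  ... | no v≁true =
    constantCut-joinFalse E-sym v∉S side inTrue inFalse none
      (λ a∈ sa → ¬-not (λ v∼a → v≁true (lose a∈ (sa , v∼a))))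
  ... | yes v∼true with find v∼true
  ...   | a , a∈ , sa , v∼a with Any.any? (λ b → (side b ≟ᵇ false) ×-dec (E v b ≟ᵇ true)) S
  ...     | no v≁false =
    constantCut-joinFalse E-sym v∉S (λ x → not (side x))
      (y₀ , y₀∈ , cong not sy₀) (x₀ , x₀∈ , cong not sx₀) (noEdgeAcross-flip E-sym none)
      (λ b∈ s'b → ¬-not (λ v∼b → v≁false (lose b∈ (not-injective s'b , v∼b))))
  ...     | yes v∼false with find v∼false
  ...       | b , b∈ , sb , v∼b with Any.any? (λ x → E v x ≟ᵇ false) S
  ...         | no v∼all =
    constantCut-universal v∉S (x₀ , x₀∈) (λ c∈ → ¬-not (λ v≁c → v∼all (lose c∈ v≁c)))
  ...         | yes v≁some with find v≁some
  ...           | x , x∈ , v≁x with side x in sx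
  ...             | true = constantCut-nonNeighbours E-sym v∉S p4 side none x∈ sx v≁x b∈ sb v∼b
  ...             | false = constantCut-nonNeighbours E-sym v∉S p4 (λ x → not (side x))
                    (noEdgeAcross-flip E-sym none) x∈ (cong not sx) v≁x a∈ (cong not sa) v∼a

  p4Free⇒constantCut : ∀ {E} → IsSymmetric E → ∀ v y S → Unique (v ∷ y ∷ S) → P4Free E (v ∷ y ∷ S) →
    ConstantCut E (v ∷ y ∷ S)
  p4Free⇒constantCut {E} E-sym v y [] u p4 =
    constantCut side (v , here refl , override-≡ v true _) (y , there (here refl) , override-≢ y≢v)
      (E v y) across
    where
      side : A → Bool
      side = override v true (λ _ → false)
      y≢v : y ≢ v
      y≢v y≡v = unique⇒head∉ u (here (sym y≡v))
      across : ∀ {a b} → a ∈ v ∷ y ∷ [] → b ∈ v ∷ y ∷ [] → side a ≡ true → side b ≡ false →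
        E a b ≡ E v y
      across (here refl) (here refl) sa sb = contradiction (trans (sym sa) sb) true≢false
      across (here refl) (there (here refl)) _ _ = refl
      across (there (here refl)) _ sa _ = contradiction (trans (sym sa) (override-≢ y≢v)) true≢false
  p4Free⇒constantCut {E} E-sym v y (z ∷ S) u p4
    with p4Free⇒constantCut E-sym y z S (unique-tail u) (p4Free-⊆ there p4)
  ... | constantCut side inTrue inFalse false across =
    constantCut-∷ E-sym (unique⇒head∉ u) p4 side inTrue inFalse across
  ... | constantCut side inTrue inFalse true across
    with constantCut-∷ (λ a b → cong not (E-sym a b)) (unique⇒head∉ u) (p4Free-complement E-sym p4)
           side inTrue inFalse (λ a∈ b∈ sa sb → cong not (across a∈ b∈ sa sb))
  ...   | constantCut side' inTrue' inFalse' b across' =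
    constantCut side' inTrue' inFalse' (not b) λ a∈ c∈ sa sc →
      trans (sym (not-involutive _)) (cong not (across' a∈ c∈ sa sc))

  Twins : (A → A → Bool) → List A → Set
  Twins E S = ∃[ x ] ∃[ y ] (x ∈ S × y ∈ S × x ≢ y ×
    (∀ {z} → z ∈ S → z ≢ x → z ≢ y → E x z ≡ E y z))

  module _ {E : A → A → Bool} (E-sym : IsSymmetric E) {S : List A} (cut : ConstantCut E S) where
    open ConstantCut cut

    constant-≢side : ∀ {x z} → x ∈ S → z ∈ S → side x ≢ side z → E x z ≡ value
    constant-≢side {x} {z} x∈ z∈ sx≢sz with side x in sx | side z in sz
    ... | true | false = isConstant x∈ z∈ sx sz
    ... | false | true = trans (E-sym x z) (isConstant z∈ x∈ sz sx)
    ... | true | true = contradiction refl sx≢sz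
    ... | false | false = contradiction refl sx≢sz

    Side : Bool → List A
    Side b = filter (λ x → side x ≟ᵇ b) S

    ∈-Side : ∀ {x} → x ∈ S → x ∈ Side (side x)
    ∈-Side x∈ = ∈-filter⁺ (λ x → side x ≟ᵇ _) x∈ refl

    Side⊆ : ∀ {b x} → x ∈ Side b → x ∈ S × side x ≡ b
    Side⊆ = ∈-filter⁻ (λ x → side x ≟ᵇ _)

    twins-Side : ∀ b → Twins E (Side b) → Twins E S
    twins-Side b (x , y , x∈ , y∈ , x≢y , twin) with Side⊆ x∈ | Side⊆ y∈
    ... | x∈S , sx | y∈S , sy = x , y , x∈S , y∈S , x≢y , twin'
      where
        twin' : ∀ {z} → z ∈ S → z ≢ x → z ≢ y → E x z ≡ E y z
        twin' {z} z∈ z≢x z≢y with side z ≟ᵇ b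
        ... | yes refl = twin (∈-Side z∈) z≢x z≢y
        ... | no sz≢b = trans (constant-≢side x∈S z∈ (λ e → sz≢b (trans (sym e) sx)))
                          (sym (constant-≢side y∈S z∈ (λ e → sz≢b (trans (sym e) sy))))

  length≤1⇒≡ : ∀ {a b : A} L → length L ≤ 1 → a ∈ L → b ∈ L → a ≡ b
  length≤1⇒≡ (x ∷ []) _ (here refl) (here refl) = refl
  length≤1⇒≡ (x ∷ x' ∷ L) (s≤s ()) _ _

  2≤length : ∀ {a b : A} L → a ∈ L → b ∈ L → a ≢ b → 2 ≤ length L
  2≤length L a∈ b∈ a≢b with 2 ≤? length L
  ... | yes two = two
  ... | no ¬two = contradiction (length≤1⇒≡ L (≤-pred (≰⇒> ¬two)) a∈ b∈) a≢b

  p4Free⇒twins : ∀ {E} → IsSymmetric E → ∀ k S → length S ≤ k → Unique S → 2 ≤ length S → P4Free E S →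
    Twins E S
  p4Free⇒twins E-sym _ [] _ _ () _
  p4Free⇒twins E-sym _ (_ ∷ []) _ _ (s≤s ()) _
  p4Free⇒twins E-sym zero (_ ∷ _ ∷ _) () _ _ _
  p4Free⇒twins {E} E-sym (suc k) (v ∷ y ∷ S') |S|≤k u _ p4
    with p4Free⇒constantCut E-sym v y S' u p4
  ... | cut@(constantCut _ (x₀ , x₀∈ , sx₀) (y₀ , y₀∈ , sy₀) _ _) = twins
    where
      S : List A
      S = v ∷ y ∷ S'
      open ConstantCut cut using (side)
      Side' : Bool → List A
      Side' = Side E-sym cut
      recurse : ∀ b x → x ∈ S → side x ≢ b → 2 ≤ length (Side' b) → Twins E S
      recurse b x x∈ sx≢b two = twins-Side E-sym cut b
        (p4Free⇒twins E-sym k (Side' b) (≤-pred (≤-trans smaller |S|≤k))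
          (filter⁺ (λ x → side x ≟ᵇ b) u) two (p4Free-⊆ (λ x∈ → proj₁ (Side⊆ E-sym cut x∈)) p4))
        where
          smaller : length (Side' b) < length S
          smaller = filter-notAll (λ x → side x ≟ᵇ b) S (lose x∈ sx≢b)
      singleton : ∀ {b x z} → ¬ (2 ≤ length (Side' b)) → x ∈ S → side x ≡ b → z ∈ S → side z ≡ b →
        z ≡ x
      singleton {b} ¬two x∈ sx z∈ sz =
        length≤1⇒≡ (Side' b) (≤-pred (≰⇒> ¬two))
          (subst (λ c → _ ∈ Side' c) sz (∈-Side E-sym cut z∈))
          (subst (λ c → _ ∈ Side' c) sx (∈-Side E-sym cut x∈))
      twins : Twins E S
      twins with 2 ≤? length (Side' true) | 2 ≤? length (Side' false)
      ... | yes two | _ = recurse true y₀ y₀∈ (λ e → true≢false (trans (sym e) sy₀)) two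
      ... | no _ | yes two = recurse false x₀ x₀∈ (λ e → true≢false (trans (sym sx₀) e)) two
      ... | no ¬two | no ¬two' =
        x₀ , y₀ , x₀∈ , y₀∈ , (λ e → true≢false (trans (sym sx₀) (trans (cong side e) sy₀))) ,
        λ z∈ z≢x₀ z≢y₀ → ⊥-elim (onNeitherSide z∈ z≢x₀ z≢y₀)
        where
          onNeitherSide : ∀ {z} → z ∈ S → z ≢ x₀ → z ≢ y₀ → ⊥
          onNeitherSide {z} z∈ z≢x₀ z≢y₀ with side z in sz
          ... | true = z≢x₀ (singleton ¬two x₀∈ sx₀ z∈ sz)
          ... | false = z≢y₀ (singleton ¬two' y₀∈ sy₀ z∈ sz)

-- Paths and accessibility in a graph-labelled tree
module TreePaths (𝒯 : GLTree) where

  V : Set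
  V = Fin (m 𝒯)

  Path : V → V → List V → Set
  Path = PathFromTo (tadj 𝒯)

  adj-sym : ∀ {x y} → Adj 𝒯 x y → Adj 𝒯 y x
  adj-sym {x} {y} = subst T (tsym 𝒯 x y)

  adj-irrefl : ∀ {x} → ¬ Adj 𝒯 x x
  adj-irrefl {x} = subst T (tirrefl 𝒯 x)

  adj⇒≢ : ∀ {x y} → Adj 𝒯 x y → x ≢ y
  adj⇒≢ x∼y refl = adj-irrefl x∼y

  leaf-unique-neighbour : ∀ {u a b} → IsLeaf 𝒯 u → Adj 𝒯 u a → Adj 𝒯 u b → a ≡ b
  leaf-unique-neighbour (_ , _ , only) u∼a u∼b = trans (only _ u∼a) (sym (only _ u∼b))

  labEdge-sym : ∀ {v a b} → LabEdge 𝒯 v a b → LabEdge 𝒯 v b a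
  labEdge-sym {v} {a} {b} = subst T (labSym 𝒯 v a b)

  second-≡ : ∀ {a b c d : V} {l l'} → _≡_ {A = List V} (a ∷ b ∷ l) (c ∷ d ∷ l') → b ≡ d
  second-≡ refl = refl

  edge-path : ∀ {a b} → Adj 𝒯 a b → Path a b (a ∷ b ∷ [])
  edge-path a∼b = (a∼b ∷ [-] , refl , refl) , unique-pair (adj⇒≢ a∼b)

  closesCycle : ∀ x a b γ δ → Adj 𝒯 x a → Adj 𝒯 x b → Linked (Adj 𝒯) ((b ∷ γ) ++ a ∷ δ) →
    Unique (x ∷ (b ∷ γ) ++ a ∷ δ) → HasCycle (tadj 𝒯)
  closesCycle x a b γ δ x∼a x∼b linked u with last-linked b γ linked
  ... | l , last≡l , l∼a =
    a , l , (a ∷ x ∷ b ∷ γ) , s≤s (s≤s (s≤s z≤n)) ,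
    ((adj-sym x∼a ∷ x∼b ∷ linked-init (b ∷ γ) (linked-prefix (b ∷ γ) linked) , refl , last≡l) ,
     unique-∷ (λ { (here a≡x) → adj⇒≢ x∼a (sym a≡x)
                 ; (there a∈) → unique-middle∉prefix (b ∷ γ) (unique-tail u) a∈ })
       (unique-∷ (λ x∈ → unique⇒head∉ u (∈-++⁺ˡ x∈)) (unique-prefix (b ∷ γ) (unique-tail u)))) ,
    l∼a

  private
    pathTails-≡ : ∀ {y} x p q → Linked (Adj 𝒯) (x ∷ p) → last (x ∷ p) ≡ just y → Unique (x ∷ p) →
      Linked (Adj 𝒯) (x ∷ q) → last (x ∷ q) ≡ just y → Unique (x ∷ q) → p ≡ q
    pathTails-≡ x [] [] _ _ _ _ _ _ = refl
    pathTails-≡ x [] (b ∷ q) _ lastp _ _ lastq uq =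
      ⊥-elim (unique⇒head∉ uq (last-∈ (b ∷ q) (trans lastq (sym lastp))))
    pathTails-≡ x (a ∷ p) [] _ lastp up _ lastq _ =
      ⊥-elim (unique⇒head∉ up (last-∈ (a ∷ p) (trans lastp (sym lastq))))
    pathTails-≡ x (a ∷ p) (b ∷ q) (x∼a ∷ lp) lastp up (x∼b ∷ lq) lastq uq with a ≟ b
    ... | yes refl = cong (a ∷_) (pathTails-≡ a p q lp lastp (unique-tail up) lq lastq (unique-tail uq))
    ... | no a≢b with Any.any? (a ≟_) (b ∷ q)
    ...   | yes a∈ with ∈-∃++ a∈
    ...     | [] , δ , refl = contradiction refl a≢b
    ...     | (.b ∷ γ) , δ , refl = ⊥-elim (tacyc 𝒯 (closesCycle x a b γ δ x∼a x∼b lq uq))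
    pathTails-≡ x (a ∷ p) (b ∷ q) (x∼a ∷ lp) lastp up (x∼b ∷ lq) lastq uq | no a≢b | no a∉ =
      ⊥-elim (unique⇒head∉ up (there (subst (x ∈_) (sym p≡xbq) (here refl))))
      where
        -- otherwise a ∷ x ∷ b ∷ q is a second simple path from a
        p≡xbq : p ≡ x ∷ b ∷ q
        p≡xbq = pathTails-≡ a p (x ∷ b ∷ q) lp lastp (unique-tail up) (adj-sym x∼a ∷ x∼b ∷ lq) lastq
          (unique-∷ (λ { (here a≡x) → adj⇒≢ x∼a (sym a≡x) ; (there a∈) → a∉ a∈ }) uq)

  path-unique : ∀ {x y} p q → Path x y p → Path x y q → p ≡ q
  path-unique (a ∷ p) (.a ∷ q) ((lp , refl , lastp) , up) ((lq , refl , lastq) , uq) =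
    cong (a ∷_) (pathTails-≡ a p q lp lastp up lq lastq uq)

  walk⇒path : ∀ {x y} w → WalkFromTo (tadj 𝒯) x y w → ∃[ p ] Path x y p
  walk⇒path (x ∷ []) (l , refl , last≡) = (x ∷ []) , ([-] , refl , last≡) , unique-∷ (λ ()) []
  walk⇒path (x ∷ x₁ ∷ w) (x∼x₁ ∷ l , refl , last≡) with walk⇒path (x₁ ∷ w) (l , refl , last≡)
  ... | π , (lπ , head≡ , lastπ) , uπ with Any.any? (x ≟_) π
  ...   | yes x∈π with ∈-∃++ x∈π
  ...     | γ , δ , refl =
    (x ∷ δ) , (linked-suffix γ lπ , refl , trans (sym (last-++ γ x δ)) lastπ) , unique-suffix γ uπ
  walk⇒path (x ∷ x₁ ∷ w) (x∼x₁ ∷ l , refl , last≡) | (.x₁ ∷ π) , (lπ , refl , lastπ) , uπ | no x∉π =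
    (x ∷ x₁ ∷ π) , (x∼x₁ ∷ lπ , refl , lastπ) , unique-∷ x∉π uπ

  path : V → V → List V
  path x y = proj₁ (walk⇒path _ (proj₂ (tconn 𝒯 x y)))

  path-isPath : ∀ x y → Path x y (path x y)
  path-isPath x y = proj₂ (walk⇒path _ (proj₂ (tconn 𝒯 x y)))

  path-canonical : ∀ {x y} p → Path x y p → p ≡ path x y
  path-canonical {x} {y} p p-path = path-unique p (path x y) p-path (path-isPath x y)

  path-from : ∀ {x y} → x ≢ y → ∃[ s ] ∃[ rest ] Path x y (x ∷ s ∷ rest)
  path-from {x} {y} x≢y with path x y | path-isPath x y
  ... | .x ∷ [] | (_ , refl , refl) , _ = contradiction refl x≢y
  ... | .x ∷ s ∷ rest | x⇝y@((_ , refl , _) , _) = s , rest , x⇝y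

  stepTowards : V → V → V
  stepTowards x y = second (path x y)
    where
      second : List V → V
      second (_ ∷ s ∷ _) = s
      second _ = x

  stepTowards-≡ : ∀ {x y s rest} → Path x y (x ∷ s ∷ rest) → stepTowards x y ≡ s
  stepTowards-≡ {x} {y} x⇝y with path x y | path-canonical _ x⇝y
  ... | _ | refl = refl

  path-viaStep : ∀ {x y} → x ≢ y → ∃[ rest ] Path x y (x ∷ stepTowards x y ∷ rest)
  path-viaStep {x} {y} x≢y with path-from x≢y
  ... | s , rest , x⇝y = rest , subst (λ s → Path x y (x ∷ s ∷ rest)) (sym (stepTowards-≡ x⇝y)) x⇝y

  path-prefix : ∀ {z x} γ {t δ} → Path z x (γ ++ t ∷ δ) → Path z t (γ ++ t ∷ [])
  path-prefix [] ((_ , head≡ , _) , _) = ([-] , head≡ , refl) , unique-∷ (λ ()) []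
  path-prefix (g ∷ γ) {t} {δ} ((l , head≡ , _) , u) =
    (linked-prefix (g ∷ γ) l , head≡ , last-++ (g ∷ γ) t []) ,
    unique-prefix (g ∷ γ ++ t ∷ []) (subst Unique (sym (++-assoc (g ∷ γ) (t ∷ []) δ)) u)

  path-upTo : ∀ {z x u t} p → Path z x (z ∷ u ∷ p) → t ∈ (u ∷ p) → ∃[ α ] Path z t (z ∷ u ∷ α)
  path-upTo p z⇝x t∈ with ∈-∃++ t∈
  ... | [] , δ , refl = [] , path-prefix (_ ∷ []) z⇝x
  ... | (.(_) ∷ γ) , δ , refl = (γ ++ _ ∷ []) , path-prefix (_ ∷ _ ∷ γ) z⇝x

  last∈branch : ∀ {z x u} p → Path z x (z ∷ u ∷ p) → x ∈ (u ∷ p)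
  last∈branch p ((_ , _ , last≡) , _) = last-∈ (_ ∷ p) last≡

  branches-disjoint : ∀ {z x y u w p q t} → u ≢ w → Path z x (z ∷ u ∷ p) → Path z y (z ∷ w ∷ q) →
    t ∈ (u ∷ p) → t ∈ (w ∷ q) → ⊥
  branches-disjoint {p = p} {q = q} u≢w z⇝x z⇝y t∈p t∈q with path-upTo p z⇝x t∈p | path-upTo q z⇝y t∈q
  ... | α , z⇝t | β , z⇝t' = u≢w (second-≡ (path-unique _ _ z⇝t z⇝t'))

  branches-ends-≢ : ∀ {z x y u w p q} → u ≢ w → Path z x (z ∷ u ∷ p) → Path z y (z ∷ w ∷ q) → x ≢ y
  branches-ends-≢ {p = p} {q = q} u≢w z⇝x z⇝y refl =
    branches-disjoint u≢w z⇝x z⇝y (last∈branch p z⇝x) (last∈branch q z⇝y)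

  -- the x,y-path through z, for x and y in different branches at z
  join : V → V → List V → V → List V → List V
  join z u p w q = (u ∷ p) ʳ++ (z ∷ w ∷ q)

  path-join : ∀ {z x y u w p q} → u ≢ w → Path z x (z ∷ u ∷ p) → Path z y (z ∷ w ∷ q) →
    Path x y (join z u p w q)
  path-join {z} {u = u} {w} {p} {q} u≢w z⇝x@((z∼u ∷ lx , _ , lastx) , ux) z⇝y@((ly , refl , lasty) , uy) =
    (linked-ʳ++ adj-sym p lx (adj-sym z∼u ∷ ly) ,
     trans (head-ʳ++ u p) lastx ,
     trans (last-ʳ++ (u ∷ p) z (w ∷ q)) lasty) ,
    unique-ʳ++ (u ∷ p) (unique-tail ux) uy disjoint
    where
      disjoint : ∀ {a} → a ∈ (u ∷ p) → a ∉ (z ∷ w ∷ q)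
      disjoint a∈ (here refl) = unique⇒head∉ ux a∈
      disjoint a∈ (there a∈') = branches-disjoint u≢w z⇝x z⇝y a∈ a∈'

  path-tail : ∀ {z x u v p} → Path z x (z ∷ u ∷ v ∷ p) → Path u x (u ∷ v ∷ p)
  path-tail ((_ ∷ linked , _ , last≡) , u) = (linked , refl , last≡) , unique-tail u

  path-reverse : ∀ {a b} ρ → Path a b ρ → Path b a (ρ ʳ++ [])
  path-reverse (x ∷ xs) ((l , refl , last≡) , u) =
    (linked-ʳ++ adj-sym xs l [-] , trans (head-ʳ++ x xs) last≡ , last-ʳ++ xs x []) ,
    unique-ʳ++ (x ∷ xs) u [] (λ _ ())

  join-extends : ∀ {z₁ z₂ x₁ x₂ ρ σ} w q → Path z₁ z₂ (z₁ ∷ x₁ ∷ ρ) → Path z₂ z₁ (z₂ ∷ x₂ ∷ σ) →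
    join z₂ x₂ σ w q ≡ z₁ ∷ x₁ ∷ ρ ++ w ∷ q
  join-extends {z₂ = z₂} {x₂ = x₂} {σ = σ} w q z₁⇝z₂ z₂⇝z₁ =
    trans (ʳ++-++ (x₂ ∷ σ) {z₂ ∷ []} {w ∷ q})
      (cong (_++ w ∷ q) (path-unique _ _ (path-reverse _ z₂⇝z₁) z₁⇝z₂))

  Along : List V → Set
  Along = AccessibleAlong 𝒯

  along-tail : ∀ a xs → Along (a ∷ xs) → Along xs
  along-tail a [] _ = tt
  along-tail a (x ∷ []) _ = tt
  along-tail a (x ∷ y ∷ xs) (_ , along) = along

  along-ʳ++⁻ : ∀ a xs b ys → Along ((a ∷ xs) ʳ++ (b ∷ ys)) → Along (b ∷ a ∷ xs) × Along (a ∷ b ∷ ys)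
  along-ʳ++⁻ a [] b ys along = tt , along
  along-ʳ++⁻ a (x ∷ xs) b ys along with along-ʳ++⁻ x xs a (b ∷ ys) along
  ... | along₁ , (bax , along₂) = (labEdge-sym bax , along₁) , along₂

  along-ʳ++⁺ : ∀ a xs b ys → Along (b ∷ a ∷ xs) → Along (a ∷ b ∷ ys) → Along ((a ∷ xs) ʳ++ (b ∷ ys))
  along-ʳ++⁺ a [] b ys _ along₂ = along₂
  along-ʳ++⁺ a (x ∷ xs) b ys (bax , along₁) along₂ =
    along-ʳ++⁺ x xs a (b ∷ ys) along₁ (labEdge-sym bax , along₂)

  along-join⁻ : ∀ z u p w q → Along (join z u p w q) →
    Along (z ∷ u ∷ p) × LabEdge 𝒯 z u w × Along (z ∷ w ∷ q)
  along-join⁻ z u p w q along with along-ʳ++⁻ u p z (w ∷ q) along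
  ... | along₁ , (uzw , along₂) = along₁ , uzw , along₂

  along-join⁺ : ∀ z u p w q → Along (z ∷ u ∷ p) → LabEdge 𝒯 z u w → Along (z ∷ w ∷ q) →
    Along (join z u p w q)
  along-join⁺ z u p w q along₁ uzw along₂ = along-ʳ++⁺ u p z (w ∷ q) along₁ (uzw , along₂)

  along-reverse : ∀ ρ → Along ρ → Along (ρ ʳ++ [])
  along-reverse [] _ = tt
  along-reverse (a ∷ []) _ = tt
  along-reverse (a ∷ b ∷ xs) along = along-ʳ++⁺ b xs a [] along tt

  accessible⇒ : ∀ {z x y u w p q} → u ≢ w → Path z x (z ∷ u ∷ p) → Path z y (z ∷ w ∷ q) →
    Accessible 𝒯 x y → Along (z ∷ u ∷ p) × LabEdge 𝒯 z u w × Along (z ∷ w ∷ q)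
  accessible⇒ {z} {u = u} {w} {p} {q} u≢w z⇝x z⇝y (_ , π , x⇝y , along) =
    along-join⁻ z u p w q (subst Along (path-unique π _ x⇝y (path-join u≢w z⇝x z⇝y)) along)

  accessible⇐ : ∀ {z x y u w p q} → u ≢ w → Path z x (z ∷ u ∷ p) → Path z y (z ∷ w ∷ q) →
    Along (z ∷ u ∷ p) → LabEdge 𝒯 z u w → Along (z ∷ w ∷ q) → Accessible 𝒯 x y
  accessible⇐ {z} {u = u} {w} {p} {q} u≢w z⇝x z⇝y along₁ uzw along₂ =
    (λ y≡x → branches-ends-≢ u≢w z⇝x z⇝y (sym y≡x)) ,
    join z u p w q , path-join u≢w z⇝x z⇝y , along-join⁺ z u p w q along₁ uzw along₂

  unique⇒length≤ : ∀ (xs : List V) → Unique xs → length xs ≤ m 𝒯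
  unique⇒length≤ xs u with length xs ≤? m 𝒯
  ... | yes ≤m = ≤m
  ... | no ≰m with pigeonhole (≰⇒> ≰m) (lookup xs)
  ...   | i , j , i<j , same = ⊥-elim (lookup-injective xs u i<j same)
    where
      lookup-injective : ∀ (xs : List V) → Unique xs → ∀ {i j} → i Fin.< j → lookup xs i ≢ lookup xs j
      lookup-injective (x ∷ xs) u {Fin.zero} {Fin.suc j} _ x≡ =
        unique⇒head∉ u (subst (_∈ xs) (sym x≡) (∈-lookup j))
      lookup-injective (x ∷ xs) u {Fin.suc i} {Fin.suc j} (s≤s i<j) = lookup-injective xs (unique-tail u) i<j

  NoIsolatedMarker : Set
  NoIsolatedMarker = ∀ u prev → Adj 𝒯 u prev → ∃[ w ] (Adj 𝒯 u w × w ≢ prev) →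
    ∃[ w ] (Adj 𝒯 u w × w ≢ prev × LabEdge 𝒯 u prev w)

  otherNeighbour? : ∀ u prev → Dec (∃[ w ] (Adj 𝒯 u w × w ≢ prev))
  otherNeighbour? u prev = any? (λ w → T? (tadj 𝒯 u w) ×-dec ¬? (w ≟ prev))

  onlyNeighbour⇒leaf : ∀ {u prev} → Adj 𝒯 u prev → ¬ (∃[ w ] (Adj 𝒯 u w × w ≢ prev)) → IsLeaf 𝒯 u
  onlyNeighbour⇒leaf {u} {prev} u∼prev noOther = prev , u∼prev , λ w u∼w → only w u∼w (w ≟ prev)
    where
      only : ∀ w → Adj 𝒯 u w → Dec (w ≡ prev) → w ≡ prev
      only w _ (yes w≡prev) = w≡prev
      only w u∼w (no w≢prev) = ⊥-elim (noOther (w , u∼w , w≢prev))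

  fresh-neighbour : ∀ {u z prev w} rest → Path u z (u ∷ prev ∷ rest) → Adj 𝒯 u w → w ≢ prev →
    w ∉ (u ∷ prev ∷ rest)
  fresh-neighbour rest _ u∼w _ (here refl) = adj-irrefl u∼w
  fresh-neighbour rest u⇝z u∼w w≢prev (there w∈) with path-upTo rest u⇝z w∈
  ... | α , u⇝w = w≢prev (sym (second-≡ (path-unique _ _ u⇝w (edge-path u∼w))))

  module _ (noIsolated : NoIsolatedMarker) where

    -- the accessible path walked so far is kept reversed, from its current end u
    private
      descend : ∀ {z u₀} fuel ext u prev rest → u ∷ prev ∷ rest ≡ ext ++ u₀ ∷ z ∷ [] →
        Path u z (u ∷ prev ∷ rest) → Along (u ∷ prev ∷ rest) → m 𝒯 ≤ length (u ∷ prev ∷ rest) + fuel →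
        ∃[ l ] ∃[ ρ ] ∃[ ext' ] (IsLeaf 𝒯 l × Path l z ρ × Along ρ × ρ ≡ ext' ++ u₀ ∷ z ∷ [])
      descend fuel ext u prev rest shape u⇝z@((u∼prev ∷ l , _ , last≡) , un) along bound
        with otherNeighbour? u prev
      ... | no noOther = u , u ∷ prev ∷ rest , ext , onlyNeighbour⇒leaf u∼prev noOther , u⇝z , along , shape
      ... | yes other with noIsolated u prev u∼prev other
      ...   | w , u∼w , w≢prev , prev∼w with fresh-neighbour rest u⇝z u∼w w≢prev
      ...     | w∉ with fuel
      ...       | zero = ⊥-elim (<-irrefl refl (≤-trans (unique⇒length≤ (w ∷ u ∷ prev ∷ rest) (unique-∷ w∉ un))
                    (subst (m 𝒯 ≤_) (+-identityʳ _) bound)))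
      ...       | suc fuel' = descend fuel' (w ∷ ext) w u (prev ∷ rest) (cong (w ∷_) shape)
                    ((adj-sym u∼w ∷ u∼prev ∷ l , refl , last≡) , unique-∷ w∉ un) (labEdge-sym prev∼w , along)
                    (subst (m 𝒯 ≤_) (+-suc _ fuel') bound)

    accessibleLeaf : ∀ {v u} → Adj 𝒯 v u →
      ∃[ l ] ∃[ q ] (IsLeaf 𝒯 l × Path v l (v ∷ u ∷ q) × Along (v ∷ u ∷ q))
    accessibleLeaf {v} {u} v∼u
      with descend (m 𝒯) [] u v [] refl (edge-path (adj-sym v∼u)) tt (m≤n+m _ _)
    ... | l , ρ , ext , leaf , l⇝v , along , refl =
      l , ext ʳ++ [] , leaf , subst (Path v l) (++-ʳ++ ext) (path-reverse ρ l⇝v) ,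
      subst Along (++-ʳ++ ext) (along-reverse ρ along)

  along? : ∀ ρ → Dec (Along ρ)
  along? (a ∷ b ∷ c ∷ ρ) = T? (lab 𝒯 b a c) ×-dec along? (b ∷ c ∷ ρ)
  along? [] = yes tt
  along? (_ ∷ []) = yes tt
  along? (_ ∷ _ ∷ []) = yes tt

  record Obstruction (ρ : List V) : Set where
    constructor obstruction
    field
      before : List V
      prev q next : V
      after : List V
      split : ρ ≡ before ++ prev ∷ q ∷ next ∷ after
      ¬turn : ¬ LabEdge 𝒯 q prev next

  ¬along⇒obstruction : ∀ ρ → ¬ Along ρ → Obstruction ρ
  ¬along⇒obstruction (a ∷ b ∷ c ∷ ρ) ¬along = atFirst (T? (lab 𝒯 b a c)) (¬along⇒obstruction (b ∷ c ∷ ρ))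
    where
      atFirst : Dec (LabEdge 𝒯 b a c) → (¬ Along (b ∷ c ∷ ρ) → Obstruction (b ∷ c ∷ ρ)) →
        Obstruction (a ∷ b ∷ c ∷ ρ)
      atFirst (no ¬abc) _ = obstruction [] a b c ρ refl ¬abc
      atFirst (yes abc) later with later (λ along → ¬along (abc , along))
      ... | obstruction γ p q r δ split ¬pqr = obstruction (a ∷ γ) p q r δ (cong (a ∷_) split) ¬pqr
  ¬along⇒obstruction [] ¬along = contradiction tt ¬along
  ¬along⇒obstruction (_ ∷ []) ¬along = contradiction tt ¬along
  ¬along⇒obstruction (_ ∷ _ ∷ []) ¬along = contradiction tt ¬along

  module _ {z x ρ} (z⇝x : Path z x ρ) (o : Obstruction ρ) where
    open Obstruction o

    obstruction-path : Path z q (before ++ prev ∷ q ∷ [])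
    obstruction-path = subst (λ l → Path z q l) (++-assoc before (prev ∷ []) (q ∷ []))
      (path-prefix (before ++ prev ∷ []) (subst (Path z x) (trans split (sym (++-assoc before (prev ∷ []) _))) z⇝x))

    private
      linked : Linked (Adj 𝒯) (prev ∷ q ∷ next ∷ after)
      linked = linked-suffix before (subst (Linked (Adj 𝒯)) split (proj₁ (proj₁ z⇝x)))

      unique : Unique (prev ∷ q ∷ next ∷ after)
      unique = unique-suffix before (subst Unique split (proj₂ z⇝x))

    obstruction-prev : Adj 𝒯 q prev
    obstruction-prev = adj-sym (Linked.head linked)

    obstruction-next : Adj 𝒯 q next
    obstruction-next = Linked.head (Linked.tail linked)

    obstruction-prev≢next : prev ≢ next
    obstruction-prev≢next prev≡next = unique⇒head∉ unique (there (here prev≡next))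

    obstruction-node : IsNode 𝒯 q
    obstruction-node leaf = obstruction-prev≢next (leaf-unique-neighbour leaf obstruction-prev obstruction-next)

    obstruction-≢start : z ≢ q
    obstruction-≢start = unique-head≢ before (subst Unique split (proj₂ z⇝x))
      (trans (cong head (sym split)) (proj₁ (proj₂ (proj₁ z⇝x))))

    obstruction-stepBack : stepTowards q z ≡ prev
    obstruction-stepBack = stepTowards-≡ (subst (Path q z) (++-ʳ++ before {prev ∷ q ∷ []} {[]})
      (path-reverse _ obstruction-path))

  centre-labEdge : ∀ {v c a} → IsStarWithCentre 𝒯 v c → Adj 𝒯 v a → a ≢ c → LabEdge 𝒯 v c a
  centre-labEdge (_ , toCentre , _) = toCentre _

  extremities-¬labEdge : ∀ {v c a b} → IsStarWithCentre 𝒯 v c → Adj 𝒯 v a → Adj 𝒯 v b →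
    a ≢ c → b ≢ c → a ≢ b → ¬ LabEdge 𝒯 v a b
  extremities-¬labEdge (_ , _ , apart) = apart _ _

  isLeaf? : ∀ v → Dec (IsLeaf 𝒯 v)
  isLeaf? v = any? λ w → T? (tadj 𝒯 v w) ×-dec all? (λ w' → T? (tadj 𝒯 v w') →-dec (w' ≟ w))

  starWithCentre? : ∀ v c → Dec (IsStarWithCentre 𝒯 v c)
  starWithCentre? v c = T? (tadj 𝒯 v c) ×-dec
    all? (λ a → T? (tadj 𝒯 v a) →-dec ¬? (a ≟ c) →-dec T? (lab 𝒯 v c a)) ×-dec
    all? (λ a → all? λ b → T? (tadj 𝒯 v a) →-dec T? (tadj 𝒯 v b) →-dec ¬? (a ≟ c) →-dec ¬? (b ≟ c) →-dec
      ¬? (a ≟ b) →-dec ¬? (T? (lab 𝒯 v a b)))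

  degenerate-¬P4 : ∀ {v a b c d} → IsCliqueLabel 𝒯 v ⊎ IsStarLabel 𝒯 v →
    Adj 𝒯 v a → Adj 𝒯 v b → Adj 𝒯 v c → Adj 𝒯 v d → a ≢ b → a ≢ c → b ≢ d →
    LabEdge 𝒯 v a b → LabEdge 𝒯 v b c → LabEdge 𝒯 v c d →
    ¬ LabEdge 𝒯 v a c → ¬ LabEdge 𝒯 v a d → ¬ LabEdge 𝒯 v b d → ⊥
  degenerate-¬P4 {a = a} {c = c} (inj₁ clique) v∼a _ v∼c _ _ a≢c _ _ _ _ ¬ac _ _ = ¬ac (clique a c v∼a v∼c a≢c)
  degenerate-¬P4 {a = a} {b} {c} {d} (inj₂ (centre , star)) v∼a v∼b v∼c v∼d a≢b a≢c b≢d ab _ _ ¬ac _ ¬bd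
    with centre ≟ a | centre ≟ b | centre ≟ c | centre ≟ d
  ... | yes refl | _ | _ | _ = ¬ac (centre-labEdge star v∼c (≢-sym a≢c))
  ... | no _ | yes refl | _ | _ = ¬bd (centre-labEdge star v∼d (≢-sym b≢d))
  ... | no _ | no _ | yes refl | _ = ¬ac (labEdge-sym (centre-labEdge star v∼a a≢c))
  ... | no _ | no _ | no _ | yes refl = ¬bd (labEdge-sym (centre-labEdge star v∼b b≢d))
  ... | no c≢a | no c≢b | no _ | no _ = extremities-¬labEdge star v∼a v∼b (≢-sym c≢a) (≢-sym c≢b) a≢b ab

  avoidingNeighbour : ∀ {v} → DegreeAtLeast3 𝒯 v → ∀ x y → ∃[ z ] (Adj 𝒯 v z × z ≢ x × z ≢ y)
  avoidingNeighbour (a , b , c , v∼a , v∼b , v∼c , a≢b , a≢c , b≢c) x y with a ≟ x | a ≟ y | b ≟ x | b ≟ y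
  ... | no a≢x | no a≢y | _ | _ = a , v∼a , a≢x , a≢y
  ... | yes refl | _ | _ | no b≢y = b , v∼b , (λ b≡a → a≢b (sym b≡a)) , b≢y
  ... | yes refl | _ | _ | yes refl = c , v∼c , (λ c≡a → a≢c (sym c≡a)) , (λ c≡b → b≢c (sym c≡b))
  ... | no _ | yes refl | no b≢x | _ = b , v∼b , b≢x , (λ b≡a → a≢b (sym b≡a))
  ... | no _ | yes refl | yes refl | _ = c , v∼c , (λ c≡b → b≢c (sym c≡b)) , (λ c≡a → a≢c (sym c≡a))

-- descend in the tree with complete labels, where every path is accessible
leafBeyond : (𝒯 : GLTree) → ∀ {v u} → Adj 𝒯 v u →
  ∃[ l ] ∃[ q ] (IsLeaf 𝒯 l × PathFromTo (tadj 𝒯) v l (v ∷ u ∷ q))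
leafBeyond 𝒯 v∼u
  with TreePaths.accessibleLeaf 𝒯ᶜ (λ _ _ _ (w , u∼w , w≢prev) → w , u∼w , w≢prev , tt) v∼u
  where
    𝒯ᶜ : GLTree
    𝒯ᶜ = record 𝒯 { lab = λ _ _ _ → true ; labSym = λ _ _ _ → refl }
... | l , q , leaf , v⇝l , _ = l , q , leaf , v⇝l

module AccessibilityGraph {n} (G : Graph n) (𝒯 : GLTree) (acc : AccessibilityGraphIs 𝒯 G) where
  open TreePaths 𝒯 public

  leafOf : Fin n → V
  leafOf = proj₁ acc

  leafOf-injective : ∀ x y → leafOf x ≡ leafOf y → x ≡ y
  leafOf-injective = proj₁ (proj₂ acc)

  leafOf-isLeaf : ∀ x → IsLeaf 𝒯 (leafOf x)
  leafOf-isLeaf = proj₁ (proj₂ (proj₂ acc))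

  leafOf-surjective : ∀ l → IsLeaf 𝒯 l → ∃[ x ] leafOf x ≡ l
  leafOf-surjective = proj₁ (proj₂ (proj₂ (proj₂ acc)))

  edge⇔accessible : ∀ x y → x ≢ y → Edge (adj G) x y ⇔ Accessible 𝒯 (leafOf x) (leafOf y)
  edge⇔accessible = proj₂ (proj₂ (proj₂ (proj₂ acc)))

  module _ {z u w p q} {g h : Fin n} (u≢w : u ≢ w)
    (z⇝g : Path z (leafOf g) (z ∷ u ∷ p)) (z⇝h : Path z (leafOf h) (z ∷ w ∷ q)) where

    leaves-≢ : g ≢ h
    leaves-≢ g≡h = branches-ends-≢ u≢w z⇝g z⇝h (cong leafOf g≡h)

    edge⇒labEdge : Edge (adj G) g h → LabEdge 𝒯 z u w
    edge⇒labEdge g∼h =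
      proj₁ (proj₂ (accessible⇒ u≢w z⇝g z⇝h (Equivalence.to (edge⇔accessible g h leaves-≢) g∼h)))

    labEdge⇒edge : Along (z ∷ u ∷ p) → LabEdge 𝒯 z u w → Along (z ∷ w ∷ q) → Edge (adj G) g h
    labEdge⇒edge along₁ uzw along₂ =
      Equivalence.from (edge⇔accessible g h leaves-≢) (accessible⇐ u≢w z⇝g z⇝h along₁ uzw along₂)

  -- Leaves g beyond prev and h beyond another neighbour are joined by a G-walk;
  -- at its step out of the prev-branch, the edge forces a label edge at prev.
  noIsolatedMarker : Connected G → NoIsolatedMarker
  noIsolatedMarker conn u prev u∼prev (w₀ , u∼w₀ , w₀≢prev)
    with leafBeyond 𝒯 u∼prev | leafBeyond 𝒯 u∼w₀
  ... | l₁ , _ , leaf₁ , u⇝l₁ | l₂ , _ , leaf₂ , u⇝l₂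
    with leafOf-surjective l₁ leaf₁ | leafOf-surjective l₂ leaf₂
  ... | g₁ , refl | g₂ , refl with conn g₁ g₂
  ... | walk , linked , head≡ , last≡
    with linked-crossing InPrevBranch? walk linked head≡ last≡
           (stepTowards-≡ u⇝l₁) (λ e → w₀≢prev (trans (sym (stepTowards-≡ u⇝l₂)) e))
    where
      InPrevBranch : Fin n → Set
      InPrevBranch g = stepTowards u (leafOf g) ≡ prev
      InPrevBranch? : ∀ g → Dec (InPrevBranch g)
      InPrevBranch? g = stepTowards u (leafOf g) ≟ prev
  ... | a , b , a∼b , a-prev , b-notPrev with path-viaStep (leaf≢u a) | path-viaStep (leaf≢u b)
    where
      leaf≢u : ∀ g → u ≢ leafOf g
      leaf≢u g u≡ = w₀≢prev (leaf-unique-neighbour (subst (IsLeaf 𝒯) (sym u≡) (leafOf-isLeaf g)) u∼w₀ u∼prev)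
  ...   | _ , u⇝a | _ , u⇝b =
    stepTowards u (leafOf b) , Linked.head (proj₁ (proj₁ u⇝b)) , b-notPrev ,
    subst (λ s → LabEdge 𝒯 u s _) a-prev (edge⇒labEdge (λ e → b-notPrev (trans (sym e) a-prev)) u⇝a u⇝b a∼b)

  record Branch (z u : V) (g : Fin n) : Set where
    constructor branch
    field
      rest   : List V
      toLeaf : Path z (leafOf g) (z ∷ u ∷ rest)
      along  : Along (z ∷ u ∷ rest)
  open Branch public

  module _ {z u w g h} (u≢w : u ≢ w) (bg : Branch z u g) (bh : Branch z w h) where

    branch-leaves-≢ : g ≢ h
    branch-leaves-≢ = leaves-≢ u≢w (toLeaf bg) (toLeaf bh)

    branch-edge⇔labEdge : Edge (adj G) g h ⇔ LabEdge 𝒯 z u w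
    branch-edge⇔labEdge = mk⇔ (edge⇒labEdge u≢w (toLeaf bg) (toLeaf bh))
      (λ uzw → labEdge⇒edge u≢w (toLeaf bg) (toLeaf bh) (along bg) uzw (along bh))

-- Labels of the split tree of a connected cograph are cliques or stars
module Labels {n} (G : Graph n) (𝒯 : GLTree) (acc : AccessibilityGraphIs 𝒯 G) (conn : Connected G) where
  open AccessibilityGraph G 𝒯 acc public
  open P4FreeGraphs (_≟_ {m 𝒯}) public

  branchTo : ∀ {z u} → Adj 𝒯 z u → ∃[ g ] Branch z u g
  branchTo z∼u with accessibleLeaf (noIsolatedMarker conn) z∼u
  ... | l , q , leaf , z⇝l , along with leafOf-surjective l leaf
  ...   | g , refl = g , branch q z⇝l along

  markers : V → List V
  markers v = filter (λ w → T? (tadj 𝒯 v w)) (allFin (m 𝒯))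

  markers-unique : ∀ v → Unique (markers v)
  markers-unique v = filter⁺ (λ w → T? (tadj 𝒯 v w)) (allFin⁺ (m 𝒯))

  ∈-markers : ∀ {v w} → Adj 𝒯 v w → w ∈ markers v
  ∈-markers {v} {w} v∼w = ∈-filter⁺ (λ w → T? (tadj 𝒯 v w)) (∈-allFin w) v∼w

  markers⇒adj : ∀ {v w} → w ∈ markers v → Adj 𝒯 v w
  markers⇒adj {v} w∈ = proj₂ (∈-filter⁻ (λ w → T? (tadj 𝒯 v w)) {xs = allFin (m 𝒯)} w∈)

  markerAdj : V → V → V → Bool
  markerAdj v x y with x ≟ y
  ... | yes _ = false
  ... | no _ = lab 𝒯 v x y

  markerAdj-≢ : ∀ {v x y} → x ≢ y → markerAdj v x y ≡ lab 𝒯 v x y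
  markerAdj-≢ {v} {x} {y} x≢y with x ≟ y
  ... | yes x≡y = contradiction x≡y x≢y
  ... | no _ = refl

  markerAdj⇒≢ : ∀ {v x y} → markerAdj v x y ≡ true → x ≢ y
  markerAdj⇒≢ {v} {x} {y} x∼y x≡y with x ≟ y
  ... | yes _ = true≢false (sym x∼y)
  ... | no x≢y = x≢y x≡y

  markerAdj-sym : ∀ v → IsSymmetric (markerAdj v)
  markerAdj-sym v x y with x ≟ y | y ≟ x
  ... | yes _ | yes _ = refl
  ... | yes x≡y | no y≢x = contradiction (sym x≡y) y≢x
  ... | no x≢y | yes y≡x = contradiction (sym y≡x) x≢y
  ... | no _ | no _ = labSym 𝒯 v x y

  markerAdj⇒labEdge : ∀ {v x y} → markerAdj v x y ≡ true → LabEdge 𝒯 v x y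
  markerAdj⇒labEdge x∼y = Equivalence.from T-≡ (trans (sym (markerAdj-≢ (markerAdj⇒≢ x∼y))) x∼y)

  ¬markerAdj⇒¬labEdge : ∀ {v x y} → x ≢ y → markerAdj v x y ≡ false → ¬ LabEdge 𝒯 v x y
  ¬markerAdj⇒¬labEdge x≢y x≁y xy =
    true≢false (trans (sym (Equivalence.to T-≡ xy)) (trans (sym (markerAdj-≢ x≢y)) x≁y))

  -- an induced P4 in a label lifts, through accessible branches, to one in G
  label-p4Free : IsCograph G → ∀ v → P4Free (markerAdj v) (markers v)
  label-p4Free cog v {a} {b} {c} {d} a∈ b∈ c∈ d∈ ab bc cd ac ad bd
    with branchTo (markers⇒adj a∈) | branchTo (markers⇒adj b∈)
       | branchTo (markers⇒adj c∈) | branchTo (markers⇒adj d∈)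
  ... | ga , ba | gb , bb | gc , bc' | gd , bd' =
    cog ga gb gc gd
      (branch-leaves-≢ a≢b ba bb , branch-leaves-≢ a≢c ba bc' , branch-leaves-≢ a≢d ba bd' ,
       branch-leaves-≢ b≢c bb bc' , branch-leaves-≢ b≢d bb bd' , branch-leaves-≢ c≢d bc' bd' ,
       Equivalence.from (branch-edge⇔labEdge a≢b ba bb) (markerAdj⇒labEdge ab) ,
       Equivalence.from (branch-edge⇔labEdge b≢c bb bc') (markerAdj⇒labEdge bc) ,
       Equivalence.from (branch-edge⇔labEdge c≢d bc' bd') (markerAdj⇒labEdge cd) ,
       (λ e → ¬markerAdj⇒¬labEdge a≢c ac (Equivalence.to (branch-edge⇔labEdge a≢c ba bc') e)) ,
       (λ e → ¬markerAdj⇒¬labEdge a≢d ad (Equivalence.to (branch-edge⇔labEdge a≢d ba bd') e)) ,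
       (λ e → ¬markerAdj⇒¬labEdge b≢d bd (Equivalence.to (branch-edge⇔labEdge b≢d bb bd') e)))
    where
      a≢b : a ≢ b
      a≢b = markerAdj⇒≢ ab
      b≢c : b ≢ c
      b≢c = markerAdj⇒≢ bc
      c≢d : c ≢ d
      c≢d = markerAdj⇒≢ cd
      a≢c : a ≢ c
      a≢c refl = true≢false (trans (sym cd) ad)
      a≢d : a ≢ d
      a≢d refl = true≢false (trans (sym cd) (trans (markerAdj-sym v c a) ac))
      b≢d : b ≢ d
      b≢d refl = true≢false (trans (sym ab) ad)

  module TwinMarkers (v : V) {x y : V} (x≢y : x ≢ y) (v∼x : Adj 𝒯 v x) (v∼y : Adj 𝒯 v y)
    (twin : ∀ {p} → p ∈ markers v → p ≢ x → p ≢ y → markerAdj v x p ≡ markerAdj v y p) where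

    InPair : V → Set
    InPair w = w ≡ x ⊎ w ≡ y

    labTwin : ∀ {p} → Adj 𝒯 v p → ¬ InPair p → lab 𝒯 v x p ≡ lab 𝒯 v y p
    labTwin v∼p p∉ =
      trans (sym (markerAdj-≢ (λ x≡p → p∉ (inj₁ (sym x≡p)))))
        (trans (twin (∈-markers v∼p) (p∉ ∘ inj₁) (p∉ ∘ inj₂)) (markerAdj-≢ (λ y≡p → p∉ (inj₂ (sym y≡p)))))

    transfer : ∀ {p q r} → Adj 𝒯 v p → ¬ InPair p → InPair q → InPair r →
      LabEdge 𝒯 v q p → LabEdge 𝒯 v r p
    transfer v∼p p∉ (inj₁ refl) (inj₁ refl) qp = qp
    transfer v∼p p∉ (inj₂ refl) (inj₂ refl) qp = qp
    transfer v∼p p∉ (inj₁ refl) (inj₂ refl) qp = subst T (labTwin v∼p p∉) qp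
    transfer v∼p p∉ (inj₂ refl) (inj₁ refl) qp = subst T (sym (labTwin v∼p p∉)) qp

    inPair : V → Bool
    inPair w = does (w ≟ x) ∨ does (w ≟ y)

    inPair-true : ∀ {w} → InPair w → inPair w ≡ true
    inPair-true {w} w∈ with w ≟ x | w ≟ y | w∈
    ... | yes _ | _ | _ = refl
    ... | no _ | yes _ | _ = refl
    ... | no w≢x | no _ | inj₁ w≡x = contradiction w≡x w≢x
    ... | no _ | no w≢y | inj₂ w≡y = contradiction w≡y w≢y

    inPair-false : ∀ {w} → ¬ InPair w → inPair w ≡ false
    inPair-false {w} w∉ with w ≟ x | w ≟ y
    ... | yes w≡x | _ = contradiction (inj₁ w≡x) w∉
    ... | no _ | yes w≡y = contradiction (inj₂ w≡y) w∉
    ... | no _ | no _ = refl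

    inPair-true⁻ : ∀ {w} → inPair w ≡ true → InPair w
    inPair-true⁻ {w} h with w ≟ x | w ≟ y
    ... | yes w≡x | _ = inj₁ w≡x
    ... | no _ | yes w≡y = inj₂ w≡y

    inPair-false⁻ : ∀ {w} → inPair w ≡ false → ¬ InPair w
    inPair-false⁻ h w∈ = true≢false (trans (sym (inPair-true w∈)) h)

    pairSplit : ∀ {z z'} → Adj 𝒯 v z → Adj 𝒯 v z' → z ≢ z' → ¬ InPair z → ¬ InPair z' →
      IsSplitOfLabel 𝒯 v inPair
    pairSplit {z} {z'} v∼z v∼z' z≢z' z∉ z'∉ =
      (x , y , x≢y , v∼x , v∼y , inPair-true (inj₁ refl) , inPair-true (inj₂ refl)) ,
      (z , z' , z≢z' , v∼z , v∼z' , inPair-false z∉ , inPair-false z'∉) ,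
      λ p q v∼p v∼q sp sq (y' , _ , sy' , py') _ →
        labEdge-sym (transfer v∼p (inPair-false⁻ sp) (inPair-true⁻ sy') (inPair-true⁻ sq) (labEdge-sym py'))

    -- z is not isolated, so it is adjacent to one twin, hence to both
    threeMarkers : ∀ {z} → Adj 𝒯 v z → ¬ InPair z → (∀ w → Adj 𝒯 v w → InPair w ⊎ w ≡ z) →
      IsCliqueLabel 𝒯 v ⊎ IsStarLabel 𝒯 v
    threeMarkers {z} v∼z z∉ onlyThree
      with noIsolatedMarker conn v z v∼z (x , v∼x , λ x≡z → z∉ (inj₁ (sym x≡z)))
    ... | w , v∼w , w≢z , zw with onlyThree w v∼w
    ...   | inj₂ w≡z = contradiction w≡z w≢z
    ...   | inj₁ w∈ with T? (lab 𝒯 v x y)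
    ...     | yes xy = inj₁ clique
      where
        clique : IsCliqueLabel 𝒯 v
        clique p q v∼p v∼q p≢q with onlyThree p v∼p | onlyThree q v∼q
        ... | inj₁ (inj₁ refl) | inj₁ (inj₁ refl) = contradiction refl p≢q
        ... | inj₁ (inj₁ refl) | inj₁ (inj₂ refl) = xy
        ... | inj₁ (inj₂ refl) | inj₁ (inj₁ refl) = labEdge-sym xy
        ... | inj₁ (inj₂ refl) | inj₁ (inj₂ refl) = contradiction refl p≢q
        ... | inj₁ p∈ | inj₂ refl = transfer v∼z z∉ w∈ p∈ (labEdge-sym zw)
        ... | inj₂ refl | inj₁ q∈ = labEdge-sym (transfer v∼z z∉ w∈ q∈ (labEdge-sym zw))
        ... | inj₂ refl | inj₂ refl = contradiction refl p≢q
    ...     | no ¬xy = inj₂ (z , v∼z , centre , extremities)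
      where
        centre : ∀ p → Adj 𝒯 v p → p ≢ z → LabEdge 𝒯 v z p
        centre p v∼p p≢z with onlyThree p v∼p
        ... | inj₁ p∈ = labEdge-sym (transfer v∼z z∉ w∈ p∈ (labEdge-sym zw))
        ... | inj₂ p≡z = contradiction p≡z p≢z
        extremities : ∀ p q → Adj 𝒯 v p → Adj 𝒯 v q → p ≢ z → q ≢ z → p ≢ q → ¬ LabEdge 𝒯 v p q
        extremities p q v∼p v∼q p≢z q≢z p≢q with onlyThree p v∼p | onlyThree q v∼q
        ... | inj₂ p≡z | _ = contradiction p≡z p≢z
        ... | _ | inj₂ q≡z = contradiction q≡z q≢z
        ... | inj₁ (inj₁ refl) | inj₁ (inj₁ refl) = contradiction refl p≢q
        ... | inj₁ (inj₁ refl) | inj₁ (inj₂ refl) = ¬xy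
        ... | inj₁ (inj₂ refl) | inj₁ (inj₁ refl) = ¬xy ∘ labEdge-sym
        ... | inj₁ (inj₂ refl) | inj₁ (inj₂ refl) = contradiction refl p≢q

    -- a fourth marker would make {x , y} one side of a split
    prime⇒cliqueOrStar : IsPrimeLabel 𝒯 v → ∀ {z} → Adj 𝒯 v z → ¬ InPair z →
      IsCliqueLabel 𝒯 v ⊎ IsStarLabel 𝒯 v
    prime⇒cliqueOrStar prime {z} v∼z z∉
      with any? (λ w → T? (tadj 𝒯 v w) ×-dec ¬? (w ≟ x) ×-dec ¬? (w ≟ y) ×-dec ¬? (w ≟ z))
    ... | yes (z' , v∼z' , z'≢x , z'≢y , z'≢z) =
      ⊥-elim (prime inPair (pairSplit v∼z v∼z' (≢-sym z'≢z) z∉ [ z'≢x , z'≢y ]))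
    ... | no noFourth = threeMarkers v∼z z∉ onlyThree
      where
        onlyThree : ∀ w → Adj 𝒯 v w → InPair w ⊎ w ≡ z
        onlyThree w v∼w with w ≟ x | w ≟ y | w ≟ z
        ... | yes w≡x | _ | _ = inj₁ (inj₁ w≡x)
        ... | no _ | yes w≡y | _ = inj₁ (inj₂ w≡y)
        ... | no _ | no _ | yes w≡z = inj₂ w≡z
        ... | no w≢x | no w≢y | no w≢z = ⊥-elim (noFourth (w , v∼w , w≢x , w≢y , w≢z))

  cliqueOrStar : IsCograph G → ∀ v → DegreeAtLeast3 𝒯 v → IsPrimeLabel 𝒯 v ⊎ IsDegenerateLabel 𝒯 v →
    IsCliqueLabel 𝒯 v ⊎ IsStarLabel 𝒯 v
  cliqueOrStar cog v _ (inj₂ degenerate) = degenerate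
  cliqueOrStar cog v deg@(a , b , _ , v∼a , v∼b , _ , a≢b , _) (inj₁ prime)
    with p4Free⇒twins (markerAdj-sym v) _ (markers v) ≤-refl (markers-unique v)
           (2≤length (markers v) (∈-markers v∼a) (∈-markers v∼b) a≢b) (label-p4Free cog v)
  ... | x , y , x∈ , y∈ , x≢y , twin with avoidingNeighbour deg x y
  ...   | z , v∼z , z≢x , z≢y =
    TwinMarkers.prime⇒cliqueOrStar v x≢y (markers⇒adj x∈) (markers⇒adj y∈) twin prime v∼z [ z≢x , z≢y ]

-- Orientation of the star nodes of the split tree of a connected cograph
module Orientation {n} (G : Graph n) (𝒯 : GLTree) (acc : AccessibilityGraphIs 𝒯 G) (conn : Connected G)
  (cog : IsCograph G) (cliqueStar : IsCliqueStarTree 𝒯) (deg3 : ∀ v → IsNode 𝒯 v → DegreeAtLeast3 𝒯 v) where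
  open Labels G 𝒯 acc conn public

  module Through {s t xs xt ρ σ} (s⇝t : Path s t (s ∷ xs ∷ ρ)) (t⇝s : Path t s (t ∷ xt ∷ σ)) where

    through-path : ∀ {w g} → w ≢ xt → (b : Branch t w g) → Path s (leafOf g) (s ∷ xs ∷ ρ ++ w ∷ rest b)
    through-path {w} w≢xt b =
      subst (Path s _) (join-extends w (rest b) s⇝t t⇝s) (path-join (λ xt≡w → w≢xt (sym xt≡w)) t⇝s (toLeaf b))

    through-along : ∀ {w g} → (b : Branch t w g) → Along (s ∷ xs ∷ ρ) → LabEdge 𝒯 t xt w →
      Along (s ∷ xs ∷ ρ ++ w ∷ rest b)
    through-along {w} b along-st turn =
      subst Along (join-extends w (rest b) s⇝t t⇝s) (along-join⁺ t xt σ w (rest b) along-ts turn (along b))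
      where
        along-ts : Along (t ∷ xt ∷ σ)
        along-ts = subst Along (path-unique _ _ (path-reverse _ s⇝t) t⇝s) (along-reverse _ along-st)

  -- Leaves beyond an extremity e_s and the centre c_s of s, and beyond the centre
  -- c_t and an extremity e_t of t, induce the P4  e_s - c_s - c_t - e_t  in G.
  accessibleBetween⇒¬pointingApart : ∀ {s t cs ct xs xt ρ σ} →
    IsNode 𝒯 s → IsNode 𝒯 t → IsStarWithCentre 𝒯 s cs → IsStarWithCentre 𝒯 t ct →
    Path s t (s ∷ xs ∷ ρ) → Path t s (t ∷ xt ∷ σ) → xs ≢ cs → xt ≢ ct → Along (s ∷ xs ∷ ρ) → ⊥
  accessibleBetween⇒¬pointingApart {s} {t} {cs} {ct} {xs} {xt} {ρ} {σ}
    node-s node-t star-s star-t s⇝t t⇝s xs≢cs xt≢ct along-st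
    with avoidingNeighbour (deg3 s node-s) cs xs | avoidingNeighbour (deg3 t node-t) ct xt
  ... | es , s∼es , es≢cs , es≢xs | et , t∼et , et≢ct , et≢xt
    with branchTo s∼es | branchTo (proj₁ star-s) | branchTo (proj₁ star-t) | branchTo t∼et
  ... | g₁ , b₁ | g₂ , b₂ | g₃ , b₃ | g₄ , b₄ =
    cog g₁ g₂ g₃ g₄
      (leaves-≢ es≢cs (toLeaf b₁) (toLeaf b₂) , leaves-≢ es≢xs (toLeaf b₁) path₃ ,
       leaves-≢ es≢xs (toLeaf b₁) path₄ ,
       leaves-≢ (≢-sym xs≢cs) (toLeaf b₂) path₃ , leaves-≢ (≢-sym et≢xt) path₂ (toLeaf b₄) ,
       leaves-≢ (≢-sym et≢ct) (toLeaf b₃) (toLeaf b₄) ,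
       labEdge⇒edge es≢cs (toLeaf b₁) (toLeaf b₂) (along b₁)
         (labEdge-sym (centre-labEdge star-s s∼es es≢cs)) (along b₂) ,
       labEdge⇒edge (≢-sym xs≢cs) (toLeaf b₂) path₃ (along b₂) (centre-labEdge star-s s∼xs xs≢cs)
         (Through.through-along s⇝t t⇝s b₃ along-st (labEdge-sym (centre-labEdge star-t t∼xt xt≢ct))) ,
       labEdge⇒edge (≢-sym et≢ct) (toLeaf b₃) (toLeaf b₄) (along b₃)
         (centre-labEdge star-t t∼et et≢ct) (along b₄) ,
       (λ e → apart-s (edge⇒labEdge es≢xs (toLeaf b₁) path₃ e)) ,
       (λ e → apart-s (edge⇒labEdge es≢xs (toLeaf b₁) path₄ e)) ,
       (λ e → extremities-¬labEdge star-t t∼xt t∼et xt≢ct et≢ct (≢-sym et≢xt)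
                (edge⇒labEdge (≢-sym et≢xt) path₂ (toLeaf b₄) e)))
    where
      s∼xs : Adj 𝒯 s xs
      s∼xs = Linked.head (proj₁ (proj₁ s⇝t))
      t∼xt : Adj 𝒯 t xt
      t∼xt = Linked.head (proj₁ (proj₁ t⇝s))
      path₂ : Path t (leafOf g₂) (t ∷ xt ∷ σ ++ cs ∷ rest b₂)
      path₂ = Through.through-path t⇝s s⇝t (≢-sym xs≢cs) b₂
      path₃ : Path s (leafOf g₃) (s ∷ xs ∷ ρ ++ ct ∷ rest b₃)
      path₃ = Through.through-path s⇝t t⇝s (≢-sym xt≢ct) b₃
      path₄ : Path s (leafOf g₄) (s ∷ xs ∷ ρ ++ et ∷ rest b₄)
      path₄ = Through.through-path s⇝t t⇝s et≢xt b₄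
      apart-s : ¬ LabEdge 𝒯 s es xs
      apart-s = extremities-¬labEdge star-s s∼es s∼xs es≢cs xs≢cs es≢xs

  -- Otherwise the s,t-path turns through a non-edge at a star node q whose centre
  -- is off the path; s and q then point apart, and q is closer to s.
  ¬pointingApart : ∀ k {s t cs ct} → IsNode 𝒯 s → IsNode 𝒯 t →
    IsStarWithCentre 𝒯 s cs → IsStarWithCentre 𝒯 t ct → s ≢ t → length (path s t) ≤ k → stepTowards s t ≢ cs → stepTowards t s ≢ ct → ⊥
  ¬pointingApart k {s} {t} node-s node-t star-s star-t s≢t |path|≤k away-s away-t
    with path-viaStep s≢t | path-viaStep (≢-sym s≢t)
  ... | ρ , s⇝t | σ , t⇝s with along? (s ∷ stepTowards s t ∷ ρ)
  ...   | yes along-st = accessibleBetween⇒¬pointingApart node-s node-t star-s star-t s⇝t t⇝s away-s away-t along-st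
  ...   | no ¬along with ¬along⇒obstruction _ ¬along
  ...     | o@(obstruction before p q r after split ¬pqr) with cliqueStar q (obstruction-node s⇝t o)
  ...       | inj₁ clique =
    ¬pqr (clique p r (obstruction-prev s⇝t o) (obstruction-next s⇝t o) (obstruction-prev≢next s⇝t o))
  ...       | inj₂ (cq , star-q) with k | prefix-firstTwo before (sym split)
  ...         | zero | _ = contradiction |path|≤k (subst (λ l → ¬ length l ≤ 0) (path-canonical _ s⇝t) λ ())
  ...         | suc k' | zs , s⇝q-shape =
    ¬pointingApart k' node-s (obstruction-node s⇝t o) star-s star-q (obstruction-≢start s⇝t o) shorter
      (λ e → away-s (trans (sym (stepTowards-≡ s⇝q)) e))
      (λ e → p≢cq (trans (sym (obstruction-stepBack s⇝t o)) e))
    where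
      s⇝q : Path s q (s ∷ stepTowards s t ∷ zs)
      s⇝q = subst (Path s q) s⇝q-shape (obstruction-path s⇝t o)
      p≢cq : p ≢ cq
      p≢cq refl = ¬pqr (centre-labEdge star-q (obstruction-next s⇝t o) (≢-sym (obstruction-prev≢next s⇝t o)))
      shorter : length (path s q) ≤ k'
      shorter = ≤-pred (≤-trans
        (subst (λ l → length l < length (path s t)) (path-canonical _ (obstruction-path s⇝t o))
          (subst (λ l → length (before ++ p ∷ q ∷ []) < length l) (trans (sym split) (path-canonical _ s⇝t))
            (prefix-shorter before)))
        |path|≤k)

  EdgeOrientingAllStars : Set
  EdgeOrientingAllStars = ∃[ a ] ∃[ b ] (Adj 𝒯 a b × (∀ u → StarNode 𝒯 u → OrientedTowardsEdge 𝒯 u a b))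

  -- Fix a leaf r.  A star pointing away from r forces every other star to point at its
  -- centre edge, or to be a deeper star pointing away; the deepest one yields the edge.
  module FromLeaf (r r₁ : V) (leaf-r : IsLeaf 𝒯 r) (r∼r₁ : Adj 𝒯 r r₁) where

    depth : V → ℕ
    depth t = length (path r t)

    PointsAway : V → V → Set
    PointsAway t c = IsNode 𝒯 t × IsStarWithCentre 𝒯 t c × stepTowards t r ≢ c

    node≢r : ∀ {t} → IsNode 𝒯 t → t ≢ r
    node≢r node-t refl = node-t leaf-r

    DeeperAway : V → V → Set
    DeeperAway s t = ∃[ ct ] (PointsAway t ct × depth s < depth t)

    -- if t is neither oriented towards the edge s c_s nor pointing apart from s, it lies
    -- in the centre branch of s
    relativeTo : ∀ {s cs} → PointsAway s cs → ∀ {t ct} → IsNode 𝒯 t → IsStarWithCentre 𝒯 t ct →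
      OrientedTowardsEdge 𝒯 t s cs ⊎ DeeperAway s t
    relativeTo {s} {cs} (node-s , star-s , away-s) {t} {ct} node-t star-t with t ≟ s
    ... | yes refl = inj₁ (cs , star-s , cs , [] , edge-path (proj₁ star-s) , [] , [] , inj₁ refl)
    ... | no t≢s with path-viaStep (≢-sym t≢s) | path-viaStep t≢s
    ...   | ρ , s⇝t | σ , t⇝s with stepTowards t s ≟ ct | stepTowards s t ≟ cs
    ...     | yes refl | yes refl =
      inj₁ (_ , star-t , s , σ , t⇝s , ρ ʳ++ [] , [] ,
        inj₂ (trans (path-unique _ _ t⇝s (path-reverse _ s⇝t)) (ʳ++-defn ρ)))
    ...     | yes refl | no xs≢cs =
      inj₁ (_ , star-t , cs , σ ++ cs ∷ [] ,
        subst (Path t cs) (join-extends cs [] t⇝s s⇝t) (path-join xs≢cs s⇝t (edge-path (proj₁ star-s))) ,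
        (stepTowards s t ∷ ρ) ʳ++ [] , [] ,
        inj₁ (trans (sym (join-extends cs [] t⇝s s⇝t)) (ʳ++-defn (stepTowards s t ∷ ρ))))
    ...     | no xt≢ct | no xs≢cs =
      ⊥-elim (¬pointingApart _ node-s node-t star-s star-t (≢-sym t≢s) ≤-refl xs≢cs xt≢ct)
    ...     | no xt≢ct | yes refl with path-viaStep (node≢r node-s)
    ...       | τ , s⇝r = inj₂ (ct , (node-t , star-t , away-t) , deeper)
      where
        t⇝r : Path t r (join s (stepTowards s t) ρ (stepTowards s r) τ)
        t⇝r = path-join (≢-sym away-s) s⇝t s⇝r
        away-t : stepTowards t r ≢ ct
        away-t e = xt≢ct (trans (sym (stepTowards-≡ (subst (Path t r) (join-extends _ τ t⇝s s⇝t) t⇝r))) e)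
        deeper : depth s < depth t
        deeper = begin-strict
          depth s                             ≡⟨ cong length (sym (path-canonical _ (path-reverse _ s⇝r))) ⟩
          length ((s ∷ y ∷ τ) ʳ++ [])         ≡⟨ trans (length-ʳ++ (s ∷ y ∷ τ)) (+-identityʳ _) ⟩
          suc (suc (length τ))                <⟨ s≤s (s≤s (s≤s (m≤m+n (length τ) (length ρ)))) ⟩
          suc (suc (suc (length τ + length ρ))) ≡⟨ cong suc (sym (trans (+-suc _ _) (cong suc (+-suc _ _)))) ⟩
          length (y ∷ τ) + length (s ∷ x ∷ ρ) ≡⟨ length-ʳ++ (y ∷ τ) ⟨
          length (join s y τ x ρ)             ≡⟨ cong length (path-canonical _ (path-join away-s s⇝r s⇝t)) ⟩
          depth t                             ∎
          where
            open ≤-Reasoning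
            x y : V
            x = stepTowards s t
            y = stepTowards s r

    relativeTo? : ∀ {s cs} → PointsAway s cs → ∀ t →
      (StarNode 𝒯 t → OrientedTowardsEdge 𝒯 t s cs) ⊎ DeeperAway s t
    relativeTo? away t with isLeaf? t
    ... | yes leaf = inj₁ λ (node , _) → contradiction leaf node
    ... | no node with any? (starWithCentre? t)
    ...   | no ¬star = inj₁ λ (_ , star) → contradiction star ¬star
    ...   | yes (_ , star) = Sum.map₁ (λ oriented _ → oriented) (relativeTo away node star)

    deepestAway : ∀ fuel {s cs} → PointsAway s cs → m 𝒯 ≤ depth s + fuel → EdgeOrientingAllStars
    deepestAway fuel {s} {cs} away@(_ , star-s , _) bound with all⊎some (relativeTo? away)
    ... | inj₁ oriented = s , cs , proj₁ star-s , oriented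
    ... | inj₂ (t , _ , away-t , deeper) with fuel
    ...   | zero = contradiction (<-≤-trans deeper (unique⇒length≤ (path r t) (proj₂ (path-isPath r t))))
                     (≤⇒≯ (subst (m 𝒯 ≤_) (+-identityʳ _) bound))
    ...   | suc fuel' = deepestAway fuel' away-t (≤-trans bound (subst (_≤ depth t + fuel') (sym (+-suc _ fuel'))
                          (+-monoˡ-≤ fuel' deeper)))

    towardsLeaf? : ∀ t → (StarNode 𝒯 t → OrientedTowardsEdge 𝒯 t r₁ r) ⊎ ∃[ ct ] PointsAway t ct
    towardsLeaf? t with isLeaf? t
    ... | yes leaf = inj₁ λ (node , _) → contradiction leaf node
    ... | no node with any? (starWithCentre? t)
    ...   | no ¬star = inj₁ λ (_ , star) → contradiction star ¬star
    ...   | yes (ct , star) with stepTowards t r ≟ ct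
    ...     | no away = inj₂ (ct , node , star , away)
    ...     | yes refl with path-viaStep (node≢r node)
    ...       | τ , t⇝r@((linked , _ , last≡) , _) with linked-lastTwo _ linked last≡ (s≤s (s≤s z≤n))
    ...         | init , p , split , p∼r with leaf-unique-neighbour leaf-r (adj-sym p∼r) r∼r₁
    ...           | refl = inj₁ λ _ → _ , star , r , τ , t⇝r , init , [] , inj₁ split

    orientation : EdgeOrientingAllStars
    orientation with all⊎some towardsLeaf?
    ... | inj₁ oriented = r₁ , r , adj-sym r∼r₁ , oriented
    ... | inj₂ (_ , _ , away) = deepestAway (m 𝒯) away (m≤n+m _ _)

  allStarsOriented : Fin n → AllStarsOriented 𝒯
  allStarsOriented x with leafOf-isLeaf x
  ... | r₁ , r∼r₁ , only = inj₂ (FromLeaf.orientation (leafOf x) r₁ (r₁ , r∼r₁ , only) r∼r₁)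

-- Oriented clique-star trees have cograph accessibility graphs
module Converse {n} (G : Graph n) (𝒯 : GLTree) (acc : AccessibilityGraphIs 𝒯 G)
  (cliqueStar : IsCliqueStarTree 𝒯) where
  open AccessibilityGraph G 𝒯 acc

  StarsPointTo : V → Set
  StarsPointTo z = ∀ q → StarNode 𝒯 q → q ≢ z → ∃[ c ] (IsStarWithCentre 𝒯 q c × stepTowards q z ≡ c)

  starsPointTo-node : ∀ w → (∀ u → StarNode 𝒯 u → OrientedTowardsNode 𝒯 u w) → StarsPointTo w
  starsPointTo-node w oriented q star _ with oriented q star
  ... | _ , c , star-c , _ , q⇝w = c , star-c , stepTowards-≡ q⇝w

  starsPointTo-edge : ∀ a b z → z ≡ a ⊎ z ≡ b → (∀ u → StarNode 𝒯 u → OrientedTowardsEdge 𝒯 u a b) →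
    StarsPointTo z
  starsPointTo-edge a b z z∈ab oriented q star q≢z with oriented q star
  ... | c , star-c , _ , p , q⇝ , xs , ys , split with z∈path xs split z∈ab
    where
      z∈path : ∀ {l} xs {ys} → l ≡ xs ++ a ∷ b ∷ ys ⊎ l ≡ xs ++ b ∷ a ∷ ys → z ≡ a ⊎ z ≡ b → z ∈ l
      z∈path xs (inj₁ refl) (inj₁ refl) = ∈-++⁺ʳ xs (here refl)
      z∈path xs (inj₁ refl) (inj₂ refl) = ∈-++⁺ʳ xs (there (here refl))
      z∈path xs (inj₂ refl) (inj₁ refl) = ∈-++⁺ʳ xs (there (here refl))
      z∈path xs (inj₂ refl) (inj₂ refl) = ∈-++⁺ʳ xs (here refl)
  ... | here q≡z = contradiction (sym q≡z) q≢z
  ... | there z∈ with path-upTo p q⇝ z∈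
  ...   | _ , q⇝z = c , star-c , stepTowards-≡ q⇝z

  -- at an obstruction q the path enters q from its centre, so the label turns
  pointedTo⇒along : ∀ {z} → StarsPointTo z → ∀ {x ρ} → Path z x ρ → Along ρ
  pointedTo⇒along {z} pointed {ρ = ρ} z⇝x with along? ρ
  ... | yes along = along
  ... | no ¬along = ⊥-elim (turns (¬along⇒obstruction ρ ¬along))
    where
      turns : Obstruction ρ → ⊥
      turns o@(obstruction _ p q r _ _ ¬pqr) with cliqueStar q (obstruction-node z⇝x o)
      ... | inj₁ clique =
        ¬pqr (clique p r (obstruction-prev z⇝x o) (obstruction-next z⇝x o) (obstruction-prev≢next z⇝x o))
      ... | inj₂ star with pointed q (obstruction-node z⇝x o , star) (≢-sym (obstruction-≢start z⇝x o))
      ...   | c , star-c , toward with trans (sym toward) (obstruction-stepBack z⇝x o)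
      ...     | refl = ¬pqr (centre-labEdge star-c (obstruction-next z⇝x o) (≢-sym (obstruction-prev≢next z⇝x o)))

  edge-sym : ∀ {x y} → Edge (adj G) x y → Edge (adj G) y x
  edge-sym {x} {y} = subst T (Graph.sym G x y)

  sameBranch-edge : ∀ {z u w g g' h} → u ≢ w → Branch z u g → Branch z u g' → Branch z w h →
    Edge (adj G) g h → Edge (adj G) g' h
  sameBranch-edge u≢w bg bg' bh g∼h =
    Equivalence.from (branch-edge⇔labEdge u≢w bg' bh) (Equivalence.to (branch-edge⇔labEdge u≢w bg bh) g∼h)

  branch-adj : ∀ {z u g} → Branch z u g → Adj 𝒯 z u
  branch-adj b = Linked.head (proj₁ (proj₁ (toLeaf b)))

  branch-leaf : ∀ {z u g} → (b : Branch z u g) → rest b ≡ [] → leafOf g ≡ u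
  branch-leaf (branch [] ((_ , _ , refl) , _) _) refl = refl

  branch-node : ∀ {z u g g'} → g ≢ g' → Branch z u g → Branch z u g' → IsNode 𝒯 u
  branch-node g≢g' bg@(branch [] _ _) bg'@(branch [] _ _) _ =
    g≢g' (leafOf-injective _ _ (trans (branch-leaf bg refl) (sym (branch-leaf bg' refl))))
  branch-node _ (branch (v ∷ _) ((z∼u ∷ u∼v ∷ _ , _ , _) , u) _) _ leaf =
    unique⇒head∉ u (there (here (leaf-unique-neighbour leaf (adj-sym z∼u) u∼v)))
  branch-node _ (branch [] _ _) (branch (v ∷ _) ((z∼u ∷ u∼v ∷ _ , _ , _) , u) _) leaf =
    unique⇒head∉ u (there (here (leaf-unique-neighbour leaf (adj-sym z∼u) u∼v)))

  branch-next : ∀ {z u g} → Branch z u g → IsNode 𝒯 u → ∃[ v ] Branch u v g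
  branch-next {g = g} (branch [] ((_ , _ , refl) , _) _) node-u = ⊥-elim (node-u (leafOf-isLeaf g))
  branch-next (branch (v ∷ p) ((_ ∷ linked , _ , last≡) , u) along) _ =
    v , branch p ((linked , refl , last≡) , unique-tail u) (along-tail _ _ along)

  module _ {a b c d} (a≢b : a ≢ b) (ab : Edge (adj G) a b) (bc : Edge (adj G) b c) (cd : Edge (adj G) c d)
    (¬ac : ¬ Edge (adj G) a c) (¬ad : ¬ Edge (adj G) a d) (¬bd : ¬ Edge (adj G) b d) where

    -- over two or three branches sameBranch-edge breaks the P4; over four, the label of z contains it
    p4-inOneBranch : ∀ {z ua ub uc ud} → IsNode 𝒯 z →
      Branch z ua a → Branch z ub b → Branch z uc c → Branch z ud d → ua ≡ ub × ua ≡ uc × ua ≡ ud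
    p4-inOneBranch {z} {ua} {ub} {uc} {ud} node-z ba bb bc' bd
      with ua ≟ ub | ua ≟ uc | ua ≟ ud | ub ≟ uc | ub ≟ ud | uc ≟ ud
    ... | yes refl | yes refl | yes refl | _ | _ | _ = refl , refl , refl
    ... | yes refl | no ua≢uc | _ | _ | _ | _ = ⊥-elim (¬ac (sameBranch-edge ua≢uc bb ba bc' bc))
    ... | yes refl | yes refl | no ua≢ud | _ | _ | _ = ⊥-elim (¬ad (sameBranch-edge ua≢ud bc' ba bd cd))
    ... | no ua≢ub | yes refl | yes refl | _ | _ | _ = ⊥-elim (¬bd (edge-sym (sameBranch-edge ua≢ub ba bd bb ab)))
    ... | no ua≢ub | yes refl | no ua≢ud | _ | _ | _ = ⊥-elim (¬ad (sameBranch-edge ua≢ud bc' ba bd cd))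
    ... | no ua≢ub | no _ | yes refl | _ | _ | _ = ⊥-elim (¬bd (edge-sym (sameBranch-edge ua≢ub ba bd bb ab)))
    ... | no ua≢ub | no _ | no _ | yes refl | _ | _ =
      ⊥-elim (¬ac (edge-sym (sameBranch-edge (≢-sym ua≢ub) bb bc' ba (edge-sym ab))))
    ... | no ua≢ub | no _ | no _ | no _ | yes refl | _ =
      ⊥-elim (¬ad (edge-sym (sameBranch-edge (≢-sym ua≢ub) bb bd ba (edge-sym ab))))
    ... | no _ | no _ | no _ | no ub≢uc | no _ | yes refl =
      ⊥-elim (¬bd (edge-sym (sameBranch-edge (≢-sym ub≢uc) bc' bd bb (edge-sym bc))))
    ... | no ua≢ub | no ua≢uc | no ua≢ud | no ub≢uc | no ub≢ud | no uc≢ud =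
      ⊥-elim (degenerate-¬P4 (cliqueStar z node-z) (branch-adj ba) (branch-adj bb) (branch-adj bc') (branch-adj bd)
        ua≢ub ua≢uc ub≢ud
        (Equivalence.to (branch-edge⇔labEdge ua≢ub ba bb) ab)
        (Equivalence.to (branch-edge⇔labEdge ub≢uc bb bc') bc)
        (Equivalence.to (branch-edge⇔labEdge uc≢ud bc' bd) cd)
        (¬ac ∘ Equivalence.from (branch-edge⇔labEdge ua≢uc ba bc'))
        (¬ad ∘ Equivalence.from (branch-edge⇔labEdge ua≢ud ba bd))
        (¬bd ∘ Equivalence.from (branch-edge⇔labEdge ub≢ud bb bd)))

    ¬P4-below : ∀ {z ua ub uc ud} p → IsNode 𝒯 z → Path z (leafOf a) (z ∷ ua ∷ p) → Along (z ∷ ua ∷ p) →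
      Branch z ub b → Branch z uc c → Branch z ud d → ⊥
    ¬P4-below p node-z z⇝a along-a bb bc' bd with p4-inOneBranch node-z (branch p z⇝a along-a) bb bc' bd
    ¬P4-below {z} {ua} [] _ z⇝a along-a bb _ _ | refl , refl , refl =
      branch-node a≢b ba bb (subst (IsLeaf 𝒯) (branch-leaf ba refl) (leafOf-isLeaf a))
      where
        ba : Branch z ua a
        ba = branch [] z⇝a along-a
    ¬P4-below {ua = ua} (v ∷ p) _ z⇝a along-a bb bc' bd | refl , refl , refl =
      ¬P4-below p node-u (path-tail z⇝a) (along-tail _ _ along-a)
        (proj₂ (branch-next bb node-u)) (proj₂ (branch-next bc' node-u)) (proj₂ (branch-next bd node-u))
      where
        node-u : IsNode 𝒯 ua
        node-u = branch-node a≢b (branch (v ∷ p) z⇝a along-a) bb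

  branchOf : ∀ {z} → StarsPointTo z → IsNode 𝒯 z → ∀ g → Branch z (stepTowards z (leafOf g)) g
  branchOf {z} pointed node-z g
    with path-viaStep {z} {leafOf g} (λ z≡ → node-z (subst (IsLeaf 𝒯) (sym z≡) (leafOf-isLeaf g)))
  ... | ρ , z⇝g = branch ρ z⇝g (pointedTo⇒along pointed z⇝g)

  pointedNode⇒cograph : ∀ {z} → StarsPointTo z → IsNode 𝒯 z → IsCograph G
  pointedNode⇒cograph pointed node-z a b c d (a≢b , _ , _ , _ , _ , _ , ab , bc , cd , ¬ac , ¬ad , ¬bd)
    with branchOf pointed node-z a
  ... | branch p z⇝a along-a =
    ¬P4-below a≢b ab bc cd ¬ac ¬ad ¬bd p node-z z⇝a along-a
      (branchOf pointed node-z b) (branchOf pointed node-z c) (branchOf pointed node-z d)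

  adjacentLeaves-cover : ∀ {a₀ b₀} → IsLeaf 𝒯 a₀ → IsLeaf 𝒯 b₀ → Adj 𝒯 a₀ b₀ →
    ∀ v → v ≡ a₀ ⊎ v ≡ b₀
  adjacentLeaves-cover {a₀} {b₀} leaf-a leaf-b a∼b v with v ≟ a₀
  ... | yes v≡a = inj₁ v≡a
  ... | no v≢a with path-from (≢-sym v≢a)
  ...   | _ , [] , ((a∼s ∷ _ , _ , refl) , _) = inj₂ (leaf-unique-neighbour leaf-a a∼s a∼b)
  ...   | _ , v' ∷ _ , ((a∼s ∷ s∼v' ∷ _ , _ , _) , u) with leaf-unique-neighbour leaf-a a∼s a∼b
  ...     | refl = ⊥-elim (unique⇒head∉ u (there (here (sym (leaf-unique-neighbour leaf-b s∼v' (adj-sym a∼b))))))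

  oriented⇒cograph : AllStarsOriented 𝒯 → IsCograph G
  oriented⇒cograph (inj₁ (w , (node-w , _) , oriented)) = pointedNode⇒cograph (starsPointTo-node w oriented) node-w
  oriented⇒cograph (inj₂ (a₀ , b₀ , a₀∼b₀ , oriented)) with isLeaf? a₀ | isLeaf? b₀
  ... | no node-a₀ | _ = pointedNode⇒cograph (starsPointTo-edge a₀ b₀ a₀ (inj₁ refl) oriented) node-a₀
  ... | yes _ | no node-b₀ = pointedNode⇒cograph (starsPointTo-edge a₀ b₀ b₀ (inj₂ refl) oriented) node-b₀
  ... | yes leaf-a₀ | yes leaf-b₀ = λ a b c d (a≢b , a≢c , _ , b≢c , _) → threeLeaves a≢b a≢c b≢c
    where
      cover : ∀ v → v ≡ a₀ ⊎ v ≡ b₀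
      cover = adjacentLeaves-cover leaf-a₀ leaf-b₀ a₀∼b₀
      collide : ∀ {x y v} → leafOf x ≡ v → leafOf y ≡ v → x ≡ y
      collide x↦v y↦v = leafOf-injective _ _ (trans x↦v (sym y↦v))
      threeLeaves : ∀ {x y z} → x ≢ y → x ≢ z → y ≢ z → ⊥
      threeLeaves {x} {y} {z} x≢y x≢z y≢z with cover (leafOf x) | cover (leafOf y) | cover (leafOf z)
      ... | inj₁ x↦ | inj₁ y↦ | _ = x≢y (collide x↦ y↦)
      ... | inj₂ x↦ | inj₂ y↦ | _ = x≢y (collide x↦ y↦)
      ... | inj₁ x↦ | _ | inj₁ z↦ = x≢z (collide x↦ z↦)
      ... | inj₂ x↦ | _ | inj₂ z↦ = x≢z (collide x↦ z↦)
      ... | _ | inj₁ y↦ | inj₁ z↦ = y≢z (collide y↦ z↦)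
      ... | _ | inj₂ y↦ | inj₂ z↦ = y≢z (collide y↦ z↦)

mainTheorem4 : ∀ {n} (G : Graph n) → 2 ≤ n → Connected G →
    (𝒯 : GLTree) → IsSplitTreeOf 𝒯 G →
    (IsCograph G ⇔ (IsCliqueStarTree 𝒯 × AllStarsOriented 𝒯))
mainTheorem4 {suc _} G (s≤s _) conn 𝒯 (acc , (degree≥3 , _) , primeOrDegenerate) =
  mk⇔ (λ cog → cliqueStar cog , Orientation.allStarsOriented G 𝒯 acc conn cog (cliqueStar cog) degree≥3 Fin.zero)
      (λ (cs , oriented) → Converse.oriented⇒cograph G 𝒯 acc cs oriented)
  where
    cliqueStar : IsCograph G → IsCliqueStarTree 𝒯
    cliqueStar cog v node = Labels.cliqueOrStar G 𝒯 acc conn cog v (degree≥3 v node) (primeOrDegenerate v node)
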